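{- Let $\mathsf K$ be a class of integral residuated lattices, $\delta$ a term-defined nucleus for $\mathsf K$, and $n\ge3$. The following are equivalent: (1) $\mathsf K$ has the amalgamation property; (2) the class $\{\mathbf A^\delta_n:\mathbf A\in\mathsf K\}$ of generalized $n$-rotations has the amalgamation property; (3) the class $\{\mathbf A^\delta_m:\mathbf A\in\mathsf K,\ m-1\text{ divides }n-1\}$ has the amalgamation property.
   Context: An IRL is a residuated lattice with $1$ as top. A term-defined nucleus for $\mathsf K$ is a unary term $\delta(x)$ in the language of residuated lattices that defines, on every $\mathbf A\in\mathsf K$, a nucleus: a closure operator with $\delta(x)\delta(y)\le\delta(xy)$. The generalized $m$-rotation $\mathbf A^\delta_m$ ($m\ge3$): first form $\mathbf A^\delta$ on $A\cup\delta[A]'$ ($\delta[A]'=\{b':b\in\delta[A]\}$ a disjoint copy), ordered by $\mathbf A$ on $A$, $b'<a$ for $b'\in\delta[A]'$, $a\in A$, and $b'\le c'$ iff $c\le b$, with multiplication that of $\mathbf A$ on $A$, $b'c'=0:=1'$, $a b'=(b/a)'$, $b'a=(a\backslash b)'$; then add new elements $\ell_1<\dots<\ell_{m-2}$ between $\delta[A]'$ and $A$, with $\ell_0=0$, $\ell_{m-1}=1$, $\ell_i\ell_j=\ell_{\max(0,i+j-m+1)}$, $a\ell_i=\ell_ia=\ell_i$, $b'\ell_i=\ell_ib'=0$; divisions are the residuals. A class has the amalgamation property if for all $\mathbf A,\mathbf B,\mathbf C$ in it and embeddings $i:\mathbf A\to\mathbf B$, $j:\mathbf A\to\mathbf C$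 there are $\mathbf D$ in the class and embeddings $h:\mathbf B\to\mathbf D$, $k:\mathbf C\to\mathbf D$ with $h\circ i=k\circ j$. -}

module Defs where

open import Level using (Level; _⊔_; Lift) renaming (suc to lsuc)
open import Data.Nat using (ℕ; zero; suc; _+_; _∸_; _<?_)
open import Data.Fin using (Fin; toℕ; fromℕ<)
import Data.Fin as F
open import Data.Product using (Σ; _×_; _,_)
open import Data.Unit.Polymorphic using (⊤)
open import Data.Empty.Polymorphic using (⊥)
open import Relation.Nullary using (yes; no)
open import Relation.Binary.Core using (Rel)
open import Algebra.Core using (Op₂)
open import Algebra.Definitions using (Congruent₂)
open import Algebra.Structures using (IsMonoid)
open import Algebra.Lattice.Structures using (IsLattice)

record RL (c ℓ : Level) : Set (lsuc (c ⊔ ℓ)) where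
  infix  4 _≈_ _≤_
  infixl 7 _·_
  field
    Carrier   : Set c
    _≈_       : Rel Carrier ℓ
    _∧_ _∨_   : Op₂ Carrier
    _·_       : Op₂ Carrier
    _\\_ _//_ : Op₂ Carrier
    ε         : Carrier
    isLattice : IsLattice _≈_ _∨_ _∧_
    isMonoid  : IsMonoid _≈_ _·_ ε
    \\-cong   : Congruent₂ _≈_ _\\_
    //-cong   : Congruent₂ _≈_ _//_

  _≤_ : Rel Carrier ℓ
  x ≤ y = (x ∧ y) ≈ x

  field
    resˡ₁ : ∀ x y z → x · y ≤ z → y ≤ x \\ z
    resˡ₂ : ∀ x y z → y ≤ x \\ z → x · y ≤ z
    resʳ₁ : ∀ x y z → x · y ≤ z → x ≤ z // y
    resʳ₂ : ∀ x y z → x ≤ z // y → x · y ≤ z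

record IRL (c ℓ : Level) : Set (lsuc (c ⊔ ℓ)) where
  field
    rl       : RL c ℓ
  open RL rl
  field
    integral : ∀ x → x ≤ ε

record FL (c ℓ : Level) : Set (lsuc (c ⊔ ℓ)) where
  field
    rl   : RL c ℓ
    zer  : RL.Carrier rl

record RLEmb {c ℓ c' ℓ'} (A : RL c ℓ) (B : RL c' ℓ') : Set (c ⊔ ℓ ⊔ c' ⊔ ℓ') where
  private
    module A = RL A
    module B = RL B
  field
    fun    : A.Carrier → B.Carrier
    cong   : ∀ {x y} → x A.≈ y → fun x B.≈ fun y
    inj    : ∀ {x y} → fun x B.≈ fun y → x A.≈ y
    pres-∧ : ∀ x y → fun (x A.∧ y) B.≈ (fun x B.∧ fun y)
    pres-∨ : ∀ x y → fun (x A.∨ y) B.≈ (fun x B.∨ fun y)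
    pres-· : ∀ x y → fun (x A.· y) B.≈ (fun x B.· fun y)
    pres-\\ : ∀ x y → fun (x A.\\ y) B.≈ (fun x B.\\ fun y)
    pres-// : ∀ x y → fun (x A.// y) B.≈ (fun x B.// fun y)
    pres-ε : fun A.ε B.≈ B.ε

record FLEmb {c ℓ c' ℓ'} (A : FL c ℓ) (B : FL c' ℓ') : Set (c ⊔ ℓ ⊔ c' ⊔ ℓ') where
  field
    emb    : RLEmb (FL.rl A) (FL.rl B)
    pres-0 : RL._≈_ (FL.rl B) (RLEmb.fun emb (FL.zer A)) (FL.zer B)

APᴵ : ∀ {c ℓ k} → (IRL c ℓ → Set k) → Set (lsuc (c ⊔ ℓ) ⊔ k)
APᴵ {c} {ℓ} P =
  (A B C : IRL c ℓ) → P A → P B → P C →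
  (i : RLEmb (IRL.rl A) (IRL.rl B)) (j : RLEmb (IRL.rl A) (IRL.rl C)) →
  Σ (IRL c ℓ) λ D → P D ×
  Σ (RLEmb (IRL.rl B) (IRL.rl D)) λ h →
  Σ (RLEmb (IRL.rl C) (IRL.rl D)) λ k →
  ∀ a → RL._≈_ (IRL.rl D) (RLEmb.fun h (RLEmb.fun i a)) (RLEmb.fun k (RLEmb.fun j a))

APᶠ : ∀ {c ℓ k} → (FL c ℓ → Set k) → Set (lsuc (c ⊔ ℓ) ⊔ k)
APᶠ {c} {ℓ} P =
  (A B C : FL c ℓ) → P A → P B → P C →
  (i : FLEmb A B) (j : FLEmb A C) →
  Σ (FL c ℓ) λ D → P D ×
  Σ (FLEmb B D) λ h →
  Σ (FLEmb C D) λ k →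
  ∀ a → RL._≈_ (FL.rl D) (RLEmb.fun (FLEmb.emb h) (RLEmb.fun (FLEmb.emb i) a))
                         (RLEmb.fun (FLEmb.emb k) (RLEmb.fun (FLEmb.emb j) a))

data Term : Set where
  var  : Term
  one  : Term
  _∧ₜ_ _∨ₜ_ _·ₜ_ _\\ₜ_ _//ₜ_ : Term → Term → Term

eval : ∀ {c ℓ} (A : RL c ℓ) → Term → RL.Carrier A → RL.Carrier A
eval A var       x = x
eval A one       x = RL.ε A
eval A (s ∧ₜ t)  x = RL._∧_ A (eval A s x) (eval A t x)
eval A (s ∨ₜ t)  x = RL._∨_ A (eval A s x) (eval A t x)
eval A (s ·ₜ t)  x = RL._·_ A (eval A s x) (eval A t x)
eval A (s \\ₜ t) x = RL._\\_ A (eval A s x) (eval A t x)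
eval A (s //ₜ t) x = RL._//_ A (eval A s x) (eval A t x)

record IsNucleus {c ℓ} (A : RL c ℓ) (δ : RL.Carrier A → RL.Carrier A) : Set (c ⊔ ℓ) where
  open RL A
  field
    extensive  : ∀ x → x ≤ δ x
    monotone   : ∀ x y → x ≤ y → δ x ≤ δ y
    idempotent : ∀ x → δ (δ x) ≈ δ x
    mult       : ∀ x y → δ x · δ y ≤ δ (x · y)

IsTermNucleus : ∀ {c ℓ k} → (IRL c ℓ → Set k) → Term → Set (lsuc (c ⊔ ℓ) ⊔ k)
IsTermNucleus {c} {ℓ} K t = (A : IRL c ℓ) → K A → IsNucleus (IRL.rl A) (eval (IRL.rl A) t)

-- The generalized m-rotation, with k = m ∸ 2 new elements ℓ₁ < … < ℓ_{m-2}.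
--   inA a  : the element a of A
--   inD a  : the element (δ a)' of δ[A]'   (representing the copy of δ[A]
--            via the surjection a ↦ δ a; its equality is induced by the order)
--   inL i  : the element ℓ_{i+1}   (i : Fin k)

data RotC {c} (X : Set c) (k : ℕ) : Set c where
  inA : X → RotC X k
  inD : X → RotC X k
  inL : Fin k → RotC X k

module Rotation {c ℓ} (A : RL c ℓ) (δ : RL.Carrier A → RL.Carrier A) (k : ℕ) where
  open RL A

  R : Set c
  R = RotC Carrier k

  _≤R_ : R → R → Set ℓ
  inA a ≤R inA b = a ≤ b
  inA a ≤R inD b = ⊥
  inA a ≤R inL j = ⊥
  inD a ≤R inA b = ⊤
  inD a ≤R inD b = δ b ≤ δ a
  inD a ≤R inL j = ⊤
  inL i ≤R inA b = ⊤
  inL i ≤R inD b = ⊥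
  inL i ≤R inL j = Lift ℓ (i F.≤ j)

  1R : R
  1R = inA ε

  0R : R            -- 0 := 1' = (δ 1)'
  0R = inD ε

  -- ℓ_n for 0 ≤ n ≤ m-1 = k+1 :  ℓ₀ = 0, ℓ_{m-1} = 1
  ℓR : ℕ → R
  ℓR zero = 0R
  ℓR (suc n) with n <? k
  ... | yes p = inL (fromℕ< p)
  ... | no _  = 1R

  _·R_ : R → R → R
  inA a ·R inA b = inA (a · b)
  inA a ·R inD b = inD (δ b // a)
  inA a ·R inL j = inL j
  inD b ·R inA a = inD (a \\ δ b)
  inD b ·R inD c = 0R
  inD b ·R inL j = 0R
  inL i ·R inA a = inL i
  inL i ·R inD b = 0R
  inL i ·R inL j = ℓR ((suc (toℕ i) + suc (toℕ j)) ∸ suc k)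
                   -- ℓ_i ℓ_j = ℓ_{max(0, i+j-m+1)}, m = k+2

-- The isomorphism is a surjective order embedding preserving ·, 1 and 0;
-- lattice operations and divisions of B are then those of A^δ_m
-- (the divisions being the residuals).
IsRotation : ∀ {c ℓ} (A : RL c ℓ) (δ : RL.Carrier A → RL.Carrier A) (m : ℕ) (B : FL c ℓ) → Set (c ⊔ ℓ)
IsRotation A δ m B =
  Σ (R → B.Carrier) λ φ →
    (∀ x y → (x ≤R y → φ x B.≤ φ y) × (φ x B.≤ φ y → x ≤R y)) ×
    (∀ b → Σ R λ x → φ x B.≈ b) ×
    (∀ x y → φ (x ·R y) B.≈ (φ x B.· φ y)) ×
    (φ 1R B.≈ B.ε) ×
    (φ 0R B.≈ FL.zer B)
  where
    open Rotation A δ (m ∸ 2)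
    module B = RL (FL.rl B)

RotClass : ∀ {c ℓ k} → (IRL c ℓ → Set k) → Term → ℕ → FL c ℓ → Set (lsuc (c ⊔ ℓ) ⊔ k)
RotClass {c} {ℓ} K t m B =
  Σ (IRL c ℓ) λ A → K A × IsRotation (IRL.rl A) (eval (IRL.rl A) t) m B

{-# OPTIONS --safe #-}
module Submission where

-- An embedding f : A^δ_m → B^δ_m' (m ≥ 3) respects the three layers.  Elements of A are exactly
-- those fixing the nonzero element ℓ₁, so f maps A into B; ℓᵢ is nilpotent while powers of
-- elements of B stay in B, and if f ℓᵢ were in δ[B]' then f (ℓᵢ \ 0) = f ℓ_{m-1-i} would lie in B.
-- Comparing ℓ_{i+1} \ ℓᵢ = ℓ_{m-2} across f shows that f ℓᵢ = ℓ_{ic} with m' - 1 = (m - 1)c, and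
-- f restricts to an embedding A → B.  Conversely an embedding A → B commutes with the term δ, so it
-- extends to A^δ_m → B^δ_m' whenever m - 1 divides m' - 1, scaling levels by (m' - 1)/(m - 1).
-- Hence an amalgamation problem in K extends to one of n-rotations whose amalgam restricts back to
-- K, and an amalgamation problem of rotations restricts to K, where an amalgam D gives D^δ_n.

open import Level using (Level; lift; lower) renaming (suc to lsuc; _⊔_ to _⊔ˡ_)
open import Data.Nat as Nat using (ℕ; zero; suc; _+_; _∸_; _*_; z≤n; s≤s; s≤s⁻¹)
import Data.Nat.Properties as ℕₚ
open import Data.Nat.Divisibility using (_∣_; ∣-refl)
open import Data.Fin as Fin using (Fin; toℕ; fromℕ<)
import Data.Fin.Properties as Finₚ
open import Data.Product using (Σ; _×_; _,_; proj₁; proj₂)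
open import Data.Sum using (_⊎_; inj₁; inj₂)
open import Data.Unit.Polymorphic using (tt)
open import Data.Empty using (⊥-elim)
open import Relation.Nullary using (yes; no; ¬_)
open import Relation.Binary.PropositionalEquality as ≡ using (_≡_; _≢_; refl)
open import Relation.Binary.Structures using (IsEquivalence; IsPartialOrder)
open import Relation.Binary.Bundles using (Setoid)
import Relation.Binary.Reasoning.Setoid as SetoidReasoning
import Relation.Binary.Lattice as OrderLattice
import Relation.Binary.Lattice.Properties.Lattice as OrderLatticeProperties
open import Algebra.Lattice.Structures using (IsLattice)
open import Algebra.Structures using (IsMonoid)
open import Function.Bundles using (_⇔_; mk⇔)
open import Defs

module TruncatedArithmetic where
  open Nat using (_≤_; _<_)
  open ℕₚ

  m∸n≤o⇒m≤n+o : ∀ m n {o} → m ∸ n ≤ o → m ≤ n + o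
  m∸n≤o⇒m≤n+o m n p = ≤-trans (m≤n+m∸n m n) (+-monoʳ-≤ n p)

  m+n∸o≡n∸[o∸m] : ∀ {m o} n → m ≤ o → m + n ∸ o ≡ n ∸ (o ∸ m)
  m+n∸o≡n∸[o∸m] {m} {o} n m≤o = begin
    m + n ∸ o             ≡⟨ ≡.cong (m + n ∸_) (≡.sym (m+[n∸m]≡n m≤o)) ⟩
    m + n ∸ (m + (o ∸ m)) ≡⟨ [m+n]∸[m+o]≡n∸o m n (o ∸ m) ⟩
    n ∸ (o ∸ m)           ∎
    where open ≡.≡-Reasoning

  m+n∸o≤p⇒n≤o∸m+p : ∀ {m o} n p → m ≤ o → m + n ∸ o ≤ p → n ≤ o ∸ m + p
  m+n∸o≤p⇒n≤o∸m+p n p m≤o q =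
    m∸n≤o⇒m≤n+o n _ (≡.subst (_≤ p) (m+n∸o≡n∸[o∸m] n m≤o) q)

  n≤o∸m+p⇒m+n∸o≤p : ∀ {m o} n p → m ≤ o → n ≤ o ∸ m + p → m + n ∸ o ≤ p
  n≤o∸m+p⇒m+n∸o≤p n p m≤o q =
    ≡.subst (_≤ p) (≡.sym (m+n∸o≡n∸[o∸m] n m≤o)) (m≤n+o⇒m∸n≤o n _ q)

  m+n∸o≡0⇒n≤o∸m : ∀ {m o} n → m ≤ o → m + n ∸ o ≡ 0 → n ≤ o ∸ m
  m+n∸o≡0⇒n≤o∸m n m≤o e = m∸n≡0⇒m≤n (≡.trans (≡.sym (m+n∸o≡n∸[o∸m] n m≤o)) e)

  n≤o∸m⇒m+n∸o≡0 : ∀ {m o} n → m ≤ o → n ≤ o ∸ m → m + n ∸ o ≡ 0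
  n≤o∸m⇒m+n∸o≡0 n m≤o q = ≡.trans (m+n∸o≡n∸[o∸m] n m≤o) (m≤n⇒m∸n≡0 q)

  o≤o∸m+p⇒m≤p : ∀ {m o} p → m ≤ o → o ≤ o ∸ m + p → m ≤ p
  o≤o∸m+p⇒m≤p {m} {o} p m≤o q =
    ≡.subst (_≤ p) (m+n∸n≡m m o) (n≤o∸m+p⇒m+n∸o≤p o p m≤o q)

  m≤p⇒o≤o∸m+p : ∀ {m o} p → m ≤ o → m ≤ p → o ≤ o ∸ m + p
  m≤p⇒o≤o∸m+p {m} {o} p m≤o q =
    m+n∸o≤p⇒n≤o∸m+p o p m≤o (≡.subst (_≤ p) (≡.sym (m+n∸n≡m m o)) q)

  [m∸o]+p∸o≡m+p∸[o+o] : ∀ m {o} p → p ≤ o → (m ∸ o) + p ∸ o ≡ m + p ∸ (o + o)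
  [m∸o]+p∸o≡m+p∸[o+o] m {o} p p≤o with o Nat.≤? m
  ... | yes o≤m = begin
    (m ∸ o) + p ∸ o ≡⟨ ≡.cong (_∸ o) (≡.sym (+-∸-comm p o≤m)) ⟩
    m + p ∸ o ∸ o   ≡⟨ ∸-+-assoc (m + p) o o ⟩
    m + p ∸ (o + o) ∎
    where open ≡.≡-Reasoning
  ... | no o≰m = begin
    (m ∸ o) + p ∸ o ≡⟨ ≡.cong (λ w → w + p ∸ o) (m≤n⇒m∸n≡0 m≤o) ⟩
    p ∸ o           ≡⟨ m≤n⇒m∸n≡0 p≤o ⟩
    0               ≡⟨ ≡.sym (m≤n⇒m∸n≡0 (+-mono-≤ m≤o p≤o)) ⟩
    m + p ∸ (o + o) ∎
    where
    open ≡.≡-Reasoning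
    m≤o : m ≤ o
    m≤o = <⇒≤ (≰⇒> o≰m)

  [m+n∸o]+p∸o≡m+[n+p∸o]∸o : ∀ m n p {o} → m ≤ o → p ≤ o →
                              (m + n ∸ o) + p ∸ o ≡ m + (n + p ∸ o) ∸ o
  [m+n∸o]+p∸o≡m+[n+p∸o]∸o m n p {o} m≤o p≤o = begin
    (m + n ∸ o) + p ∸ o ≡⟨ [m∸o]+p∸o≡m+p∸[o+o] (m + n) p p≤o ⟩
    m + n + p ∸ (o + o) ≡⟨ ≡.cong (_∸ (o + o)) (≡.trans (+-assoc m n p) (+-comm m (n + p))) ⟩
    (n + p) + m ∸ (o + o) ≡⟨ ≡.sym ([m∸o]+p∸o≡m+p∸[o+o] (n + p) m m≤o) ⟩
    (n + p ∸ o) + m ∸ o ≡⟨ ≡.cong (_∸ o) (+-comm (n + p ∸ o) m) ⟩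
    m + (n + p ∸ o) ∸ o ∎
    where open ≡.≡-Reasoning

  m+n∸[1+o]≤o : ∀ {m n o} → m ≤ o → n ≤ o → m + n ∸ suc o ≤ o
  m+n∸[1+o]≤o {m} {n} {o} m≤o n≤o =
    m≤n+o⇒m∸n≤o (m + n) (suc o) (≤-trans (+-mono-≤ m≤o n≤o) (n≤1+n (o + o)))

  m+n∸[1+m]≡n∸1 : ∀ m n → m + n ∸ suc m ≡ n ∸ 1
  m+n∸[1+m]≡n∸1 zero    n = refl
  m+n∸[1+m]≡n∸1 (suc m) n = m+n∸[1+m]≡n∸1 m n

  m≤o⇒m+[o∸n]∸[1+o]≤o∸[1+n] : ∀ {m o} n → m ≤ o → m + (o ∸ n) ∸ suc o ≤ o ∸ suc n
  m≤o⇒m+[o∸n]∸[1+o]≤o∸[1+n] {m} {o} n m≤o = begin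
    m + (o ∸ n) ∸ suc o ≤⟨ ∸-monoˡ-≤ (suc o) (+-monoˡ-≤ (o ∸ n) m≤o) ⟩
    o + (o ∸ n) ∸ suc o ≡⟨ m+n∸[1+m]≡n∸1 o (o ∸ n) ⟩
    o ∸ n ∸ 1           ≡⟨ ∸-+-assoc o n 1 ⟩
    o ∸ (n + 1)         ≡⟨ ≡.cong (o ∸_) (+-comm n 1) ⟩
    o ∸ suc n           ∎
    where open ≤-Reasoning

  n≡m∸p+q⇒p≡m∸n+q : ∀ m n p q → p ≤ m → n ≤ m → n ≡ m ∸ p + q → p ≡ m ∸ n + q
  n≡m∸p+q⇒p≡m∸n+q m n p q p≤m n≤m e = +-cancelʳ-≡ n p (m ∸ n + q) (begin
    p + n             ≡⟨ ≡.cong (p +_) e ⟩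
    p + (m ∸ p + q)   ≡⟨ ≡.sym (+-assoc p (m ∸ p) q) ⟩
    p + (m ∸ p) + q   ≡⟨ ≡.cong (_+ q) (m+[n∸m]≡n p≤m) ⟩
    m + q             ≡⟨ ≡.cong (_+ q) (≡.sym (m∸n+n≡m n≤m)) ⟩
    m ∸ n + n + q     ≡⟨ +-assoc (m ∸ n) n q ⟩
    m ∸ n + (n + q)   ≡⟨ ≡.cong (m ∸ n +_) (+-comm n q) ⟩
    m ∸ n + (q + n)   ≡⟨ ≡.sym (+-assoc (m ∸ n) q n) ⟩
    m ∸ n + q + n     ∎)
    where open ≡.≡-Reasoning

  suc[m∸2]≡m∸1 : ∀ {m} → 2 ≤ m → suc (m ∸ 2) ≡ m ∸ 1
  suc[m∸2]≡m∸1 (s≤s (s≤s _)) = refl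

  1≤m∸2 : ∀ {m} → 3 ≤ m → 1 ≤ m ∸ 2
  1≤m∸2 (s≤s (s≤s (s≤s _))) = s≤s z≤n

  suc[n∸2]≡suc[m∸2]*quotient : ∀ {m n} → 2 ≤ m → 2 ≤ n → (m∣n : (m ∸ 1) ∣ (n ∸ 1)) →
                                suc (n ∸ 2) ≡ suc (m ∸ 2) * _∣_.quotient m∣n
  suc[n∸2]≡suc[m∸2]*quotient {m} {n} m≥2 n≥2 m∣n = begin
    suc (n ∸ 2)        ≡⟨ suc[m∸2]≡m∸1 n≥2 ⟩
    n ∸ 1              ≡⟨ _∣_.equality m∣n ⟩
    q * (m ∸ 1)        ≡⟨ *-comm q (m ∸ 1) ⟩
    (m ∸ 1) * q        ≡⟨ ≡.cong (_* q) (suc[m∸2]≡m∸1 m≥2) ⟨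
    suc (m ∸ 2) * q    ∎
    where
    open ≡.≡-Reasoning
    q : ℕ
    q = _∣_.quotient m∣n

module RLProperties {c ℓ : Level} (A : RL c ℓ) where
  open RL A
  open IsLattice isLattice public using (isEquivalence; ∧-comm; ∧-assoc; ∨-comm; ∨-assoc; ∧-cong; ∨-cong; absorptive)
  open IsEquivalence isEquivalence public renaming (refl to ≈-refl; sym to ≈-sym; trans to ≈-trans)
  open IsMonoid isMonoid public using (assoc; identityˡ; identityʳ) renaming (∙-cong to ·-cong)

  ∧-absorbs-∨ : ∀ x y → (x ∧ (x ∨ y)) ≈ x
  ∧-absorbs-∨ = proj₂ absorptive

  ∨-absorbs-∧ : ∀ x y → (x ∨ (x ∧ y)) ≈ x
  ∨-absorbs-∧ = proj₁ absorptive

  ∧-idem : ∀ x → (x ∧ x) ≈ x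
  ∧-idem x = ≈-trans (∧-cong ≈-refl (≈-sym (∨-absorbs-∧ x x))) (∧-absorbs-∨ x (x ∧ x))

  ≤-refl : ∀ {x} → x ≤ x
  ≤-refl {x} = ∧-idem x

  ≤-reflexive : ∀ {x y} → x ≈ y → x ≤ y
  ≤-reflexive {x} e = ≈-trans (∧-cong ≈-refl (≈-sym e)) (∧-idem x)

  ≤-trans : ∀ {x y z} → x ≤ y → y ≤ z → x ≤ z
  ≤-trans {x} {y} {z} p q =
    ≈-trans (∧-cong (≈-sym p) ≈-refl) (≈-trans (∧-assoc x y z) (≈-trans (∧-cong ≈-refl q) p))

  ≤-antisym : ∀ {x y} → x ≤ y → y ≤ x → x ≈ y
  ≤-antisym {x} {y} p q = ≈-trans (≈-sym p) (≈-trans (∧-comm x y) q)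

  ≤-resp-≈ : ∀ {x x' y y'} → x ≈ x' → y ≈ y' → x ≤ y → x' ≤ y'
  ≤-resp-≈ e₁ e₂ p = ≤-trans (≤-reflexive (≈-sym e₁)) (≤-trans p (≤-reflexive e₂))

  x∧y≤x : ∀ x y → (x ∧ y) ≤ x
  x∧y≤x x y = ≈-trans (∧-comm (x ∧ y) x) (≈-trans (≈-sym (∧-assoc x x y)) (∧-cong (∧-idem x) ≈-refl))

  x∧y≤y : ∀ x y → (x ∧ y) ≤ y
  x∧y≤y x y = ≤-trans (≤-reflexive (∧-comm x y)) (x∧y≤x y x)

  ∧-greatest : ∀ {x y z} → z ≤ x → z ≤ y → z ≤ (x ∧ y)
  ∧-greatest {x} {y} {z} p q = ≈-trans (≈-sym (∧-assoc z x y)) (≈-trans (∧-cong p ≈-refl) q)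

  x≤x∨y : ∀ x y → x ≤ (x ∨ y)
  x≤x∨y = ∧-absorbs-∨

  y≤x∨y : ∀ x y → y ≤ (x ∨ y)
  y≤x∨y x y = ≤-trans (x≤x∨y y x) (≤-reflexive (∨-comm y x))

  ∨-least : ∀ {x y z} → x ≤ z → y ≤ z → (x ∨ y) ≤ z
  ∨-least {x} {y} {z} p q =
    ≤-resp-≈ ≈-refl (≈-trans (∨-assoc x y z) (≈-trans (∨-cong ≈-refl (≤⇒∨ q)) (≤⇒∨ p))) (x≤x∨y (x ∨ y) z)
    where
    ≤⇒∨ : ∀ {u v} → u ≤ v → (u ∨ v) ≈ v
    ≤⇒∨ {u} {v} r = ≈-trans (∨-cong (≈-trans (≈-sym r) (∧-comm u v)) ≈-refl)
                             (≈-trans (∨-comm (v ∧ u) v) (∨-absorbs-∧ v u))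

  ·-monoˡ : ∀ {x x'} y → x ≤ x' → (x · y) ≤ (x' · y)
  ·-monoˡ {x} {x'} y p = resʳ₂ x y (x' · y) (≤-trans p (resʳ₁ x' y (x' · y) ≤-refl))

  ·-monoʳ : ∀ x {y y'} → y ≤ y' → (x · y) ≤ (x · y')
  ·-monoʳ x {y} {y'} p = resˡ₂ x y (x · y') (≤-trans p (resˡ₁ x y' (x · y') ≤-refl))

  \\-eval : ∀ x z → (x · (x \\ z)) ≤ z
  \\-eval x z = resˡ₂ x (x \\ z) z ≤-refl

  //-eval : ∀ x z → ((z // x) · x) ≤ z
  //-eval x z = resʳ₂ (z // x) x z ≤-refl

  //-// : ∀ z a b → ((z // b) // a) ≈ (z // (a · b))
  //-// z a b = ≤-antisym
    (resʳ₁ _ _ _ (≤-trans (≤-reflexive (≈-sym (assoc _ a b)))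
       (≤-trans (·-monoˡ b (//-eval a (z // b))) (//-eval b z))))
    (resʳ₁ _ _ _ (resʳ₁ _ _ _ (≤-trans (≤-reflexive (assoc _ a b)) (//-eval (a · b) z))))

  \\-\\ : ∀ z a b → (a \\ (b \\ z)) ≈ ((b · a) \\ z)
  \\-\\ z a b = ≤-antisym
    (resˡ₁ _ _ _ (≤-trans (≤-reflexive (assoc b a _))
       (≤-trans (·-monoʳ b (\\-eval a (b \\ z))) (\\-eval b z))))
    (resˡ₁ _ _ _ (resˡ₁ _ _ _ (≤-trans (≤-reflexive (≈-sym (assoc b a _))) (\\-eval (b · a) z))))

  \\-//-comm : ∀ x z y → ((x \\ z) // y) ≈ (x \\ (z // y))
  \\-//-comm x z y = ≤-antisym
    (resˡ₁ _ _ _ (resʳ₁ _ _ _ (≤-trans (≤-reflexive (assoc x _ y))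
       (≤-trans (·-monoʳ x (//-eval y (x \\ z))) (\\-eval x z)))))
    (resʳ₁ _ _ _ (resˡ₁ _ _ _ (≤-trans (≤-reflexive (≈-sym (assoc x _ y)))
       (≤-trans (·-monoˡ y (\\-eval x (z // y))) (//-eval y z)))))

  ε\\x≈x : ∀ x → (ε \\ x) ≈ x
  ε\\x≈x x = ≤-antisym (≤-trans (≤-reflexive (≈-sym (identityˡ _))) (\\-eval ε x))
                        (resˡ₁ _ _ _ (≤-reflexive (identityˡ x)))

  x//ε≈x : ∀ x → (x // ε) ≈ x
  x//ε≈x x = ≤-antisym (≤-trans (≤-reflexive (≈-sym (identityʳ _))) (//-eval ε x))
                        (resʳ₁ _ _ _ (≤-reflexive (identityʳ x)))

module NucleusProperties {c ℓ : Level} (A : RL c ℓ) (δ : RL.Carrier A → RL.Carrier A) (N : IsNucleus A δ) where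
  open RL A
  open RLProperties A
  open IsNucleus N

  δ-mono : ∀ {x y} → x ≤ y → δ x ≤ δ y
  δ-mono = monotone _ _

  δ-cong : ∀ {x y} → x ≈ y → δ x ≈ δ y
  δ-cong e = ≤-antisym (δ-mono (≤-reflexive e)) (δ-mono (≤-reflexive (≈-sym e)))

  x≤δy⇒δx≤δy : ∀ {x y} → x ≤ δ y → δ x ≤ δ y
  x≤δy⇒δx≤δy p = ≤-trans (δ-mono p) (≤-reflexive (idempotent _))

  δ[δb//a]≈δb//a : ∀ b a → δ (δ b // a) ≈ (δ b // a)
  δ[δb//a]≈δb//a b a = ≤-antisym
    (resʳ₁ _ _ _ (≤-trans (·-monoʳ _ (extensive a))
      (≤-trans (mult _ a) (x≤δy⇒δx≤δy (//-eval a (δ b))))))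
    (extensive _)

  δ[a\\δb]≈a\\δb : ∀ b a → δ (a \\ δ b) ≈ (a \\ δ b)
  δ[a\\δb]≈a\\δb b a = ≤-antisym
    (resˡ₁ _ _ _ (≤-trans (·-monoˡ _ (extensive a))
      (≤-trans (mult a _) (x≤δy⇒δx≤δy (\\-eval a (δ b))))))
    (extensive _)

  δ[δa∧δb]≈δa∧δb : ∀ a b → δ (δ a ∧ δ b) ≈ (δ a ∧ δ b)
  δ[δa∧δb]≈δa∧δb a b = ≤-antisym
    (∧-greatest (x≤δy⇒δx≤δy (x∧y≤x _ _)) (x≤δy⇒δx≤δy (x∧y≤y _ _)))
    (extensive _)

  δ[δc·a]≈δ[c·a] : ∀ c a → δ (δ c · a) ≈ δ (c · a)
  δ[δc·a]≈δ[c·a] c a = ≤-antisym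
    (x≤δy⇒δx≤δy (≤-trans (·-monoʳ _ (extensive a)) (mult c a)))
    (δ-mono (·-monoˡ a (extensive c)))

  δ[a·δc]≈δ[a·c] : ∀ a c → δ (a · δ c) ≈ δ (a · c)
  δ[a·δc]≈δ[a·c] a c = ≤-antisym
    (x≤δy⇒δx≤δy (≤-trans (·-monoˡ _ (extensive a)) (mult a c)))
    (δ-mono (·-monoʳ a (extensive c)))

  δ∨-least : ∀ {a b c} → δ a ≤ δ c → δ b ≤ δ c → δ (a ∨ b) ≤ δ c
  δ∨-least p q = x≤δy⇒δx≤δy (∨-least (≤-trans (extensive _) p) (≤-trans (extensive _) q))

  δc≤δ[δb//a]⇒δ[c·a]≤δb : ∀ a b c → δ c ≤ δ (δ b // a) → δ (c · a) ≤ δ b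
  δc≤δ[δb//a]⇒δ[c·a]≤δb a b c p = ≤-trans (≤-reflexive (≈-sym (δ[δc·a]≈δ[c·a] c a)))
    (x≤δy⇒δx≤δy (resʳ₂ _ _ _ (≤-trans p (≤-reflexive (δ[δb//a]≈δb//a b a)))))

  δ[c·a]≤δb⇒δc≤δ[δb//a] : ∀ a b c → δ (c · a) ≤ δ b → δ c ≤ δ (δ b // a)
  δ[c·a]≤δb⇒δc≤δ[δb//a] a b c p =
    ≤-trans (resʳ₁ _ _ _ (≤-trans (extensive _) (≤-trans (≤-reflexive (δ[δc·a]≈δ[c·a] c a)) p))) (extensive _)

  δc≤δ[a\\δb]⇒δ[a·c]≤δb : ∀ a b c → δ c ≤ δ (a \\ δ b) → δ (a · c) ≤ δ b
  δc≤δ[a\\δb]⇒δ[a·c]≤δb a b c p = ≤-trans (≤-reflexive (≈-sym (δ[a·δc]≈δ[a·c] a c)))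
    (x≤δy⇒δx≤δy (resˡ₂ _ _ _ (≤-trans p (≤-reflexive (δ[a\\δb]≈a\\δb b a)))))

  δ[a·c]≤δb⇒δc≤δ[a\\δb] : ∀ a b c → δ (a · c) ≤ δ b → δ c ≤ δ (a \\ δ b)
  δ[a·c]≤δb⇒δc≤δ[a\\δb] a b c p =
    ≤-trans (resˡ₁ _ _ _ (≤-trans (extensive _) (≤-trans (≤-reflexive (δ[a·δc]≈δ[a·c] a c)) p))) (extensive _)

  δc≤δ[a\\δb]⇒a≤δb//δc : ∀ a b c → δ c ≤ δ (a \\ δ b) → a ≤ (δ b // δ c)
  δc≤δ[a\\δb]⇒a≤δb//δc a b c p = resʳ₁ _ _ _ (resˡ₂ _ _ _ (≤-trans p (≤-reflexive (δ[a\\δb]≈a\\δb b a))))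

  a≤δb//δc⇒δc≤δ[a\\δb] : ∀ a b c → a ≤ (δ b // δ c) → δ c ≤ δ (a \\ δ b)
  a≤δb//δc⇒δc≤δ[a\\δb] a b c p = ≤-trans (resˡ₁ _ _ _ (resʳ₂ _ _ _ p)) (extensive _)

  δc≤δ[δb//a]⇒a≤δc\\δb : ∀ a b c → δ c ≤ δ (δ b // a) → a ≤ (δ c \\ δ b)
  δc≤δ[δb//a]⇒a≤δc\\δb a b c p = resˡ₁ _ _ _ (resʳ₂ _ _ _ (≤-trans p (≤-reflexive (δ[δb//a]≈δb//a b a))))

  a≤δc\\δb⇒δc≤δ[δb//a] : ∀ a b c → a ≤ (δ c \\ δ b) → δ c ≤ δ (δ b // a)
  a≤δc\\δb⇒δc≤δ[δb//a] a b c p = ≤-trans (resʳ₁ _ _ _ (resˡ₂ _ _ _ p)) (extensive _)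

module RotationAlgebra {c ℓ : Level} (A : IRL c ℓ) (δ : RL.Carrier (IRL.rl A) → RL.Carrier (IRL.rl A))
                       (N : IsNucleus (IRL.rl A) δ) (k : ℕ) where
  open IRL A using (rl; integral)
  open RL rl
  open RLProperties rl
  open NucleusProperties rl δ N
  open IsNucleus N using (extensive)
  open TruncatedArithmetic
  open Rotation rl δ k public

  -- κ = m - 1, so that ℓR 0 = 0R and ℓR κ = 1R.
  κ : ℕ
  κ = suc k

  level : Fin k → ℕ
  level i = suc (toℕ i)

  level≤k : ∀ i → level i Nat.≤ k
  level≤k = Finₚ.toℕ<n

  level≤κ : ∀ i → level i Nat.≤ κ
  level≤κ i = ℕₚ.m≤n⇒m≤1+n (level≤k i)

  ℓR-level : ∀ i → ℓR (level i) ≡ inL i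
  ℓR-level i with toℕ i Nat.<? k
  ... | yes p = ≡.cong inL (Finₚ.fromℕ<-toℕ i p)
  ... | no ¬p = ⊥-elim (¬p (Finₚ.toℕ<n i))

  ℓR-≥κ : ∀ {n} → κ Nat.≤ n → ℓR n ≡ 1R
  ℓR-≥κ {suc n} (s≤s k≤n) with n Nat.<? k
  ... | yes n<k = ⊥-elim (ℕₚ.<⇒≱ n<k k≤n)
  ... | no _ = refl

  data LevelView : ℕ → Set where
    bottom : LevelView 0
    middle : ∀ i → LevelView (level i)
    above  : ∀ {n} → κ Nat.≤ n → LevelView n

  levelView : ∀ n → LevelView n
  levelView zero = bottom
  levelView (suc n) with n Nat.<? k
  ... | yes n<k = ≡.subst (λ m → LevelView (suc m)) (Finₚ.toℕ-fromℕ< n<k) (middle (fromℕ< n<k))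
  ... | no n≮k = above (s≤s (ℕₚ.≮⇒≥ n≮k))

  infix 4 _⊑_ _≈R_
  record _⊑_ (x y : R) : Set ℓ where
    constructor ⟪_⟫
    field out : x ≤R y
  open _⊑_ public

  _≈R_ : R → R → Set ℓ
  x ≈R y = (x ⊑ y) × (y ⊑ x)

  ⊑-refl : ∀ {x} → x ⊑ x
  ⊑-refl {inA a} = ⟪ ≤-refl ⟫
  ⊑-refl {inD a} = ⟪ ≤-refl ⟫
  ⊑-refl {inL i} = ⟪ lift ℕₚ.≤-refl ⟫

  ⊑-trans : ∀ {x y z} → x ⊑ y → y ⊑ z → x ⊑ z
  ⊑-trans {inA a} {inA b} {inA c} ⟪ p ⟫ ⟪ q ⟫ = ⟪ ≤-trans p q ⟫
  ⊑-trans {inA a} {inA b} {inD c} p ⟪ () ⟫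
  ⊑-trans {inA a} {inA b} {inL c} p ⟪ () ⟫
  ⊑-trans {inA a} {inD b} ⟪ () ⟫ q
  ⊑-trans {inA a} {inL b} ⟪ () ⟫ q
  ⊑-trans {inD a} {y} {inA c} p q = ⟪ tt ⟫
  ⊑-trans {inD a} {inA b} {inD c} p ⟪ () ⟫
  ⊑-trans {inD a} {inD b} {inD c} ⟪ p ⟫ ⟪ q ⟫ = ⟪ ≤-trans q p ⟫
  ⊑-trans {inD a} {inL b} {inD c} p ⟪ () ⟫
  ⊑-trans {inD a} {y} {inL c} p q = ⟪ tt ⟫
  ⊑-trans {inL a} {y} {inA c} p q = ⟪ tt ⟫
  ⊑-trans {inL a} {inA b} {inD c} p ⟪ () ⟫
  ⊑-trans {inL a} {inD b} {inD c} ⟪ () ⟫ q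
  ⊑-trans {inL a} {inL b} {inD c} p ⟪ () ⟫
  ⊑-trans {inL a} {inA b} {inL c} p ⟪ () ⟫
  ⊑-trans {inL a} {inD b} {inL c} ⟪ () ⟫ q
  ⊑-trans {inL a} {inL b} {inL c} ⟪ lift p ⟫ ⟪ lift q ⟫ = ⟪ lift (ℕₚ.≤-trans p q) ⟫

  ⊑-respˡ-≡ : ∀ {x x' y} → x ≡ x' → x ⊑ y → x' ⊑ y
  ⊑-respˡ-≡ refl p = p

  ⊑-respʳ-≡ : ∀ {x y y'} → y ≡ y' → x ⊑ y → x ⊑ y'
  ⊑-respʳ-≡ refl p = p

  ≈R-refl : ∀ {x} → x ≈R x
  ≈R-refl = ⊑-refl , ⊑-refl

  ≈R-sym : ∀ {x y} → x ≈R y → y ≈R x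
  ≈R-sym (p , q) = q , p

  ≈R-trans : ∀ {x y z} → x ≈R y → y ≈R z → x ≈R z
  ≈R-trans (p , q) (p' , q') = ⊑-trans p p' , ⊑-trans q' q

  ≈R-reflexive : ∀ {x y} → x ≡ y → x ≈R y
  ≈R-reflexive refl = ≈R-refl

  inA-≈ : ∀ {a b} → a ≈ b → inA a ≈R inA b
  inA-≈ e = ⟪ ≤-reflexive e ⟫ , ⟪ ≤-reflexive (≈-sym e) ⟫

  inD-≈ : ∀ {a b} → δ a ≈ δ b → inD a ≈R inD b
  inD-≈ e = ⟪ ≤-reflexive (≈-sym e) ⟫ , ⟪ ≤-reflexive e ⟫

  inA-≈⁻ : ∀ {a b} → inA a ≈R inA b → a ≈ b
  inA-≈⁻ (⟪ p ⟫ , ⟪ q ⟫) = ≤-antisym p q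

  ⊑1R : ∀ x → x ⊑ 1R
  ⊑1R (inA a) = ⟪ integral a ⟫
  ⊑1R (inD a) = ⟪ tt ⟫
  ⊑1R (inL i) = ⟪ tt ⟫

  0R⊑ : ∀ x → 0R ⊑ x
  0R⊑ (inA a) = ⟪ tt ⟫
  0R⊑ (inD a) = ⟪ δ-mono (integral a) ⟫
  0R⊑ (inL i) = ⟪ tt ⟫

  ℓR⊑inD⇒≡0 : ∀ n c → ℓR n ⊑ inD c → n ≡ 0
  ℓR⊑inD⇒≡0 n c p with levelView n
  ... | bottom = refl
  ... | middle i rewrite ℓR-level i with p
  ... | ⟪ () ⟫
  ℓR⊑inD⇒≡0 n c p | above κ≤n rewrite ℓR-≥κ κ≤n with p
  ... | ⟪ () ⟫

  ℓR⊑inL⇒≤level : ∀ n j → ℓR n ⊑ inL j → n Nat.≤ level j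
  ℓR⊑inL⇒≤level n j p with levelView n
  ... | bottom = z≤n
  ... | middle i rewrite ℓR-level i = s≤s (lower (out p))
  ... | above κ≤n rewrite ℓR-≥κ κ≤n with p
  ... | ⟪ () ⟫

  ≤level⇒ℓR⊑inL : ∀ n j → n Nat.≤ level j → ℓR n ⊑ inL j
  ≤level⇒ℓR⊑inL n j n≤j with levelView n
  ... | bottom = ⟪ tt ⟫
  ... | middle i rewrite ℓR-level i = ⟪ lift (s≤s⁻¹ n≤j) ⟫
  ... | above κ≤n = ⊥-elim (ℕₚ.<⇒≱ (s≤s (level≤k j)) (ℕₚ.≤-trans κ≤n n≤j))

  inL⊑ℓR⇒level≤ : ∀ t n → inL t ⊑ ℓR n → level t Nat.≤ n
  inL⊑ℓR⇒level≤ t n p with levelView n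
  ... | bottom with p
  ... | ⟪ () ⟫
  inL⊑ℓR⇒level≤ t n p | middle i rewrite ℓR-level i = s≤s (lower (out p))
  inL⊑ℓR⇒level≤ t n p | above κ≤n = ℕₚ.≤-trans (level≤κ t) κ≤n

  level≤⇒inL⊑ℓR : ∀ t n → level t Nat.≤ n → inL t ⊑ ℓR n
  level≤⇒inL⊑ℓR t n t≤n with levelView n
  ... | bottom = ⊥-elim (ℕₚ.n≮0 t≤n)
  ... | middle i rewrite ℓR-level i = ⟪ lift (s≤s⁻¹ t≤n) ⟫
  ... | above κ≤n rewrite ℓR-≥κ κ≤n = ⟪ tt ⟫

  inD⊑ℓR : ∀ b n → 1 Nat.≤ n → inD b ⊑ ℓR n
  inD⊑ℓR b n 1≤n with levelView n
  ... | bottom = ⊥-elim (ℕₚ.n≮0 1≤n)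
  ... | middle i rewrite ℓR-level i = ⟪ tt ⟫
  ... | above κ≤n rewrite ℓR-≥κ κ≤n = ⟪ tt ⟫

  inA⊑ℓR⇒κ≤ : ∀ a n → inA a ⊑ ℓR n → κ Nat.≤ n
  inA⊑ℓR⇒κ≤ a n p with levelView n
  ... | bottom with p
  ... | ⟪ () ⟫
  inA⊑ℓR⇒κ≤ a n p | middle i rewrite ℓR-level i with p
  ... | ⟪ () ⟫
  inA⊑ℓR⇒κ≤ a n p | above κ≤n = κ≤n

  κ≤⇒inA⊑ℓR : ∀ a n → κ Nat.≤ n → inA a ⊑ ℓR n
  κ≤⇒inA⊑ℓR a n κ≤n rewrite ℓR-≥κ κ≤n = ⊑1R (inA a)

  ℓR⊑inA : ∀ n c → n Nat.≤ k → ℓR n ⊑ inA c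
  ℓR⊑inA n c n≤k with levelView n
  ... | bottom = ⟪ tt ⟫
  ... | middle i rewrite ℓR-level i = ⟪ tt ⟫
  ... | above κ≤n = ⊥-elim (ℕₚ.<⇒≱ κ≤n n≤k)

  infixl 7 _⊓_
  infixl 6 _⊔_

  _⊓_ : Fin k → Fin k → Fin k
  i ⊓ j with i Finₚ.≤? j
  ... | yes _ = i
  ... | no _ = j

  _⊔_ : Fin k → Fin k → Fin k
  i ⊔ j with i Finₚ.≤? j
  ... | yes _ = j
  ... | no _ = i

  i⊓j≤i : ∀ (i j : Fin k) → i ⊓ j Fin.≤ i
  i⊓j≤i i j with i Finₚ.≤? j
  ... | yes _ = ℕₚ.≤-refl
  ... | no i≰j = ℕₚ.<⇒≤ (ℕₚ.≰⇒> i≰j)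

  i⊓j≤j : ∀ (i j : Fin k) → i ⊓ j Fin.≤ j
  i⊓j≤j i j with i Finₚ.≤? j
  ... | yes i≤j = i≤j
  ... | no _ = ℕₚ.≤-refl

  ⊓-greatest : ∀ {i j t : Fin k} → t Fin.≤ i → t Fin.≤ j → t Fin.≤ i ⊓ j
  ⊓-greatest {i} {j} p q with i Finₚ.≤? j
  ... | yes _ = p
  ... | no _ = q

  i≤i⊔j : ∀ (i j : Fin k) → i Fin.≤ i ⊔ j
  i≤i⊔j i j with i Finₚ.≤? j
  ... | yes i≤j = i≤j
  ... | no _ = ℕₚ.≤-refl

  j≤i⊔j : ∀ (i j : Fin k) → j Fin.≤ i ⊔ j
  j≤i⊔j i j with i Finₚ.≤? j
  ... | yes _ = ℕₚ.≤-refl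
  ... | no i≰j = ℕₚ.<⇒≤ (ℕₚ.≰⇒> i≰j)

  ⊔-least : ∀ {i j t : Fin k} → i Fin.≤ t → j Fin.≤ t → i ⊔ j Fin.≤ t
  ⊔-least {i} {j} p q with i Finₚ.≤? j
  ... | yes _ = q
  ... | no _ = p

  infixr 7 _∧R_
  infixr 6 _∨R_
  _∧R_ : R → R → R
  inA a ∧R inA b = inA (a ∧ b)
  inA a ∧R inD b = inD b
  inA a ∧R inL j = inL j
  inD a ∧R inA b = inD a
  inD a ∧R inD b = inD (a ∨ b)
  inD a ∧R inL j = inD a
  inL i ∧R inA b = inL i
  inL i ∧R inD b = inD b
  inL i ∧R inL j = inL (i ⊓ j)

  _∨R_ : R → R → R
  inA a ∨R inA b = inA (a ∨ b)
  inA a ∨R inD b = inA a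
  inA a ∨R inL j = inA a
  inD a ∨R inA b = inA b
  inD a ∨R inD b = inD (δ a ∧ δ b)
  inD a ∨R inL j = inL j
  inL i ∨R inA b = inA b
  inL i ∨R inD b = inL i
  inL i ∨R inL j = inL (i ⊔ j)

  x∧Ry⊑x : ∀ x y → (x ∧R y) ⊑ x
  x∧Ry⊑x (inA a) (inA b) = ⟪ x∧y≤x a b ⟫
  x∧Ry⊑x (inA a) (inD b) = ⟪ tt ⟫
  x∧Ry⊑x (inA a) (inL j) = ⟪ tt ⟫
  x∧Ry⊑x (inD a) (inA b) = ⊑-refl
  x∧Ry⊑x (inD a) (inD b) = ⟪ δ-mono (x≤x∨y a b) ⟫
  x∧Ry⊑x (inD a) (inL j) = ⊑-refl
  x∧Ry⊑x (inL i) (inA b) = ⊑-refl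
  x∧Ry⊑x (inL i) (inD b) = ⟪ tt ⟫
  x∧Ry⊑x (inL i) (inL j) = ⟪ lift (i⊓j≤i i j) ⟫

  x∧Ry⊑y : ∀ x y → (x ∧R y) ⊑ y
  x∧Ry⊑y (inA a) (inA b) = ⟪ x∧y≤y a b ⟫
  x∧Ry⊑y (inA a) (inD b) = ⊑-refl
  x∧Ry⊑y (inA a) (inL j) = ⊑-refl
  x∧Ry⊑y (inD a) (inA b) = ⟪ tt ⟫
  x∧Ry⊑y (inD a) (inD b) = ⟪ δ-mono (y≤x∨y a b) ⟫
  x∧Ry⊑y (inD a) (inL j) = ⟪ tt ⟫
  x∧Ry⊑y (inL i) (inA b) = ⟪ tt ⟫
  x∧Ry⊑y (inL i) (inD b) = ⊑-refl
  x∧Ry⊑y (inL i) (inL j) = ⟪ lift (i⊓j≤j i j) ⟫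

  ∧R-greatest : ∀ {x y z} → z ⊑ x → z ⊑ y → z ⊑ (x ∧R y)
  ∧R-greatest {inA a} {inA b} {inA c} ⟪ p ⟫ ⟪ q ⟫ = ⟪ ∧-greatest p q ⟫
  ∧R-greatest {inA a} {inA b} {inD c} p q = ⟪ tt ⟫
  ∧R-greatest {inA a} {inA b} {inL c} p q = ⟪ tt ⟫
  ∧R-greatest {inA a} {inD b} {z} p q = q
  ∧R-greatest {inA a} {inL b} {z} p q = q
  ∧R-greatest {inD a} {inA b} {z} p q = p
  ∧R-greatest {inD a} {inD b} {inA c} () q
  ∧R-greatest {inD a} {inD b} {inD c} ⟪ p ⟫ ⟪ q ⟫ = ⟪ δ∨-least p q ⟫
  ∧R-greatest {inD a} {inD b} {inL c} ⟪ () ⟫ q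
  ∧R-greatest {inD a} {inL b} {z} p q = p
  ∧R-greatest {inL a} {inA b} {z} p q = p
  ∧R-greatest {inL a} {inD b} {z} p q = q
  ∧R-greatest {inL a} {inL b} {inA c} ⟪ () ⟫ q
  ∧R-greatest {inL a} {inL b} {inD c} p q = ⟪ tt ⟫
  ∧R-greatest {inL a} {inL b} {inL c} ⟪ lift p ⟫ ⟪ lift q ⟫ = ⟪ lift (⊓-greatest p q) ⟫

  x⊑x∨Ry : ∀ x y → x ⊑ (x ∨R y)
  x⊑x∨Ry (inA a) (inA b) = ⟪ x≤x∨y a b ⟫
  x⊑x∨Ry (inA a) (inD b) = ⊑-refl
  x⊑x∨Ry (inA a) (inL j) = ⊑-refl
  x⊑x∨Ry (inD a) (inA b) = ⟪ tt ⟫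
  x⊑x∨Ry (inD a) (inD b) = ⟪ ≤-trans (≤-reflexive (δ[δa∧δb]≈δa∧δb a b)) (x∧y≤x _ _) ⟫
  x⊑x∨Ry (inD a) (inL j) = ⟪ tt ⟫
  x⊑x∨Ry (inL i) (inA b) = ⟪ tt ⟫
  x⊑x∨Ry (inL i) (inD b) = ⊑-refl
  x⊑x∨Ry (inL i) (inL j) = ⟪ lift (i≤i⊔j i j) ⟫

  y⊑x∨Ry : ∀ x y → y ⊑ (x ∨R y)
  y⊑x∨Ry (inA a) (inA b) = ⟪ y≤x∨y a b ⟫
  y⊑x∨Ry (inA a) (inD b) = ⟪ tt ⟫
  y⊑x∨Ry (inA a) (inL j) = ⟪ tt ⟫
  y⊑x∨Ry (inD a) (inA b) = ⊑-refl
  y⊑x∨Ry (inD a) (inD b) = ⟪ ≤-trans (≤-reflexive (δ[δa∧δb]≈δa∧δb a b)) (x∧y≤y _ _) ⟫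
  y⊑x∨Ry (inD a) (inL j) = ⊑-refl
  y⊑x∨Ry (inL i) (inA b) = ⊑-refl
  y⊑x∨Ry (inL i) (inD b) = ⟪ tt ⟫
  y⊑x∨Ry (inL i) (inL j) = ⟪ lift (j≤i⊔j i j) ⟫

  ∨R-least : ∀ {x y z} → x ⊑ z → y ⊑ z → (x ∨R y) ⊑ z
  ∨R-least {inA a} {inA b} {inA c} ⟪ p ⟫ ⟪ q ⟫ = ⟪ ∨-least p q ⟫
  ∨R-least {inA a} {inA b} {inD c} ⟪ () ⟫ q
  ∨R-least {inA a} {inA b} {inL c} ⟪ () ⟫ q
  ∨R-least {inA a} {inD b} {z} p q = p
  ∨R-least {inA a} {inL b} {z} p q = p
  ∨R-least {inD a} {inA b} {z} p q = q
  ∨R-least {inD a} {inD b} {inA c} p q = ⟪ tt ⟫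
  ∨R-least {inD a} {inD b} {inD c} ⟪ p ⟫ ⟪ q ⟫ = ⟪ ≤-trans (∧-greatest p q) (extensive _) ⟫
  ∨R-least {inD a} {inD b} {inL c} p q = ⟪ tt ⟫
  ∨R-least {inD a} {inL b} {z} p q = q
  ∨R-least {inL a} {inA b} {z} p q = q
  ∨R-least {inL a} {inD b} {z} p q = p
  ∨R-least {inL a} {inL b} {inA c} p q = ⟪ tt ⟫
  ∨R-least {inL a} {inL b} {inD c} ⟪ () ⟫ q
  ∨R-least {inL a} {inL b} {inL c} ⟪ lift p ⟫ ⟪ lift q ⟫ = ⟪ lift (⊔-least p q) ⟫

  -- ℓR n is 1 for every n ≥ κ, so the level formulas below need no truncation at the top.
  infixl 7 _\\R_ _//R_
  _\\R_ : R → R → R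
  inA a \\R inA c = inA (a \\ c)
  inA a \\R inD c = inD (c · a)
  inA a \\R inL j = inL j
  inD b \\R inA c = inA ε
  inD b \\R inD c = inA (δ b // δ c)
  inD b \\R inL j = inA ε
  inL i \\R inA c = inA ε
  inL i \\R inD c = ℓR (κ ∸ level i)
  inL i \\R inL j = ℓR (κ ∸ level i + level j)

  _//R_ : R → R → R
  inA c //R inA a = inA (c // a)
  inD c //R inA a = inD (a · c)
  inL j //R inA a = inL j
  inA c //R inD b = inA ε
  inD c //R inD b = inA (δ c \\ δ b)
  inL j //R inD b = inA ε
  inA c //R inL i = inA ε
  inD c //R inL i = ℓR (κ ∸ level i)
  inL j //R inL i = ℓR (κ ∸ level i + level j)

  1≤κ∸level : ∀ i → 1 Nat.≤ κ ∸ level i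
  1≤κ∸level i = ℕₚ.m<n⇒0<n∸m (s≤s (level≤k i))

  κ∸level≤k : ∀ i → κ ∸ level i Nat.≤ k
  κ∸level≤k i = ℕₚ.m∸n≤m k (toℕ i)

  1≤n+level : ∀ i n → 1 Nat.≤ n + level i
  1≤n+level i n = ℕₚ.≤-trans (s≤s z≤n) (ℕₚ.m≤n+m (level i) n)

  level+level∸κ≤k : ∀ i t → level i + level t ∸ κ Nat.≤ k
  level+level∸κ≤k i t = m+n∸[1+o]≤o (level≤k i) (level≤k t)

  ·R⊑⇒⊑\\R : ∀ x y z → (x ·R y) ⊑ z → y ⊑ (x \\R z)
  ·R⊑⇒⊑\\R (inA a) (inA b) (inA c) ⟪ p ⟫ = ⟪ resˡ₁ a b c p ⟫
  ·R⊑⇒⊑\\R (inA a) (inD b) (inA c) p = ⟪ tt ⟫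
  ·R⊑⇒⊑\\R (inA a) (inL t) (inA c) p = ⟪ tt ⟫
  ·R⊑⇒⊑\\R (inA a) (inA b) (inD c) ⟪ () ⟫
  ·R⊑⇒⊑\\R (inA a) (inD b) (inD c) ⟪ p ⟫ = ⟪ δc≤δ[δb//a]⇒δ[c·a]≤δb a b c p ⟫
  ·R⊑⇒⊑\\R (inA a) (inL t) (inD c) ⟪ () ⟫
  ·R⊑⇒⊑\\R (inA a) (inA b) (inL j) ⟪ () ⟫
  ·R⊑⇒⊑\\R (inA a) (inD b) (inL j) p = ⟪ tt ⟫
  ·R⊑⇒⊑\\R (inA a) (inL t) (inL j) p = p
  ·R⊑⇒⊑\\R (inD b) y (inA c) p = ⊑1R y
  ·R⊑⇒⊑\\R (inD b) (inA a) (inD c) ⟪ p ⟫ = ⟪ δc≤δ[a\\δb]⇒a≤δb//δc a b c p ⟫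
  ·R⊑⇒⊑\\R (inD b) (inD a) (inD c) p = ⟪ tt ⟫
  ·R⊑⇒⊑\\R (inD b) (inL t) (inD c) p = ⟪ tt ⟫
  ·R⊑⇒⊑\\R (inD b) y (inL j) p = ⊑1R y
  ·R⊑⇒⊑\\R (inL i) y (inA c) p = ⊑1R y
  ·R⊑⇒⊑\\R (inL i) (inA a) (inD c) ⟪ () ⟫
  ·R⊑⇒⊑\\R (inL i) (inD b) (inD c) p = inD⊑ℓR b _ (1≤κ∸level i)
  ·R⊑⇒⊑\\R (inL i) (inL t) (inD c) p =
    level≤⇒inL⊑ℓR t _ (m+n∸o≡0⇒n≤o∸m (level t) (level≤κ i) (ℓR⊑inD⇒≡0 _ c p))
  ·R⊑⇒⊑\\R (inL i) (inA a) (inL j) ⟪ lift p ⟫ = κ≤⇒inA⊑ℓR a _ (m≤p⇒o≤o∸m+p (level j) (level≤κ i) (s≤s p))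
  ·R⊑⇒⊑\\R (inL i) (inD b) (inL j) p = inD⊑ℓR b _ (1≤n+level j (κ ∸ level i))
  ·R⊑⇒⊑\\R (inL i) (inL t) (inL j) p =
    level≤⇒inL⊑ℓR t _ (m+n∸o≤p⇒n≤o∸m+p (level t) (level j) (level≤κ i) (ℓR⊑inL⇒≤level _ j p))

  ⊑\\R⇒·R⊑ : ∀ x y z → y ⊑ (x \\R z) → (x ·R y) ⊑ z
  ⊑\\R⇒·R⊑ (inA a) (inA b) (inA c) ⟪ p ⟫ = ⟪ resˡ₂ a b c p ⟫
  ⊑\\R⇒·R⊑ (inA a) (inD b) (inA c) p = ⟪ tt ⟫
  ⊑\\R⇒·R⊑ (inA a) (inL t) (inA c) p = ⟪ tt ⟫
  ⊑\\R⇒·R⊑ (inA a) (inA b) (inD c) ⟪ () ⟫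
  ⊑\\R⇒·R⊑ (inA a) (inD b) (inD c) ⟪ p ⟫ = ⟪ δ[c·a]≤δb⇒δc≤δ[δb//a] a b c p ⟫
  ⊑\\R⇒·R⊑ (inA a) (inL t) (inD c) ⟪ () ⟫
  ⊑\\R⇒·R⊑ (inA a) (inA b) (inL j) ⟪ () ⟫
  ⊑\\R⇒·R⊑ (inA a) (inD b) (inL j) p = ⟪ tt ⟫
  ⊑\\R⇒·R⊑ (inA a) (inL t) (inL j) p = p
  ⊑\\R⇒·R⊑ (inD b) (inA a) (inA c) p = ⟪ tt ⟫
  ⊑\\R⇒·R⊑ (inD b) (inD a) (inA c) p = ⟪ tt ⟫
  ⊑\\R⇒·R⊑ (inD b) (inL t) (inA c) p = ⟪ tt ⟫
  ⊑\\R⇒·R⊑ (inD b) (inA a) (inD c) ⟪ p ⟫ = ⟪ a≤δb//δc⇒δc≤δ[a\\δb] a b c p ⟫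
  ⊑\\R⇒·R⊑ (inD b) (inD a) (inD c) p = 0R⊑ _
  ⊑\\R⇒·R⊑ (inD b) (inL t) (inD c) p = 0R⊑ _
  ⊑\\R⇒·R⊑ (inD b) (inA a) (inL j) p = ⟪ tt ⟫
  ⊑\\R⇒·R⊑ (inD b) (inD a) (inL j) p = ⟪ tt ⟫
  ⊑\\R⇒·R⊑ (inD b) (inL t) (inL j) p = ⟪ tt ⟫
  ⊑\\R⇒·R⊑ (inL i) (inA a) (inA c) p = ⟪ tt ⟫
  ⊑\\R⇒·R⊑ (inL i) (inD a) (inA c) p = ⟪ tt ⟫
  ⊑\\R⇒·R⊑ (inL i) (inL t) (inA c) p = ℓR⊑inA _ c (level+level∸κ≤k i t)
  ⊑\\R⇒·R⊑ (inL i) (inA a) (inD c) p = ⊥-elim (ℕₚ.<⇒≱ (s≤s (κ∸level≤k i)) (inA⊑ℓR⇒κ≤ a _ p))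
  ⊑\\R⇒·R⊑ (inL i) (inD b) (inD c) p = 0R⊑ _
  ⊑\\R⇒·R⊑ (inL i) (inL t) (inD c) p =
    ⊑-respˡ-≡ (≡.cong ℓR (≡.sym (n≤o∸m⇒m+n∸o≡0 (level t) (level≤κ i) (inL⊑ℓR⇒level≤ t _ p)))) (0R⊑ _)
  ⊑\\R⇒·R⊑ (inL i) (inA a) (inL j) p = ⟪ lift (s≤s⁻¹ (o≤o∸m+p⇒m≤p (level j) (level≤κ i) (inA⊑ℓR⇒κ≤ a _ p))) ⟫
  ⊑\\R⇒·R⊑ (inL i) (inD b) (inL j) p = 0R⊑ _
  ⊑\\R⇒·R⊑ (inL i) (inL t) (inL j) p =
    ≤level⇒ℓR⊑inL _ j (n≤o∸m+p⇒m+n∸o≤p (level t) (level j) (level≤κ i) (inL⊑ℓR⇒level≤ t _ p))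

  ℓR-+-comm : ∀ t i → ℓR (level t + level i ∸ κ) ≡ ℓR (level i + level t ∸ κ)
  ℓR-+-comm t i = ≡.cong (λ w → ℓR (w ∸ κ)) (ℕₚ.+-comm (level t) (level i))

  ·R⊑⇒⊑//R : ∀ x y z → (x ·R y) ⊑ z → x ⊑ (z //R y)
  ·R⊑⇒⊑//R (inA b) (inA a) (inA c) ⟪ p ⟫ = ⟪ resʳ₁ b a c p ⟫
  ·R⊑⇒⊑//R (inD b) (inA a) (inA c) p = ⟪ tt ⟫
  ·R⊑⇒⊑//R (inL t) (inA a) (inA c) p = ⟪ tt ⟫
  ·R⊑⇒⊑//R (inA b) (inA a) (inD c) ⟪ () ⟫
  ·R⊑⇒⊑//R (inD b) (inA a) (inD c) ⟪ p ⟫ = ⟪ δc≤δ[a\\δb]⇒δ[a·c]≤δb a b c p ⟫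
  ·R⊑⇒⊑//R (inL t) (inA a) (inD c) ⟪ () ⟫
  ·R⊑⇒⊑//R (inA b) (inA a) (inL j) ⟪ () ⟫
  ·R⊑⇒⊑//R (inD b) (inA a) (inL j) p = ⟪ tt ⟫
  ·R⊑⇒⊑//R (inL t) (inA a) (inL j) p = p
  ·R⊑⇒⊑//R x (inD b) (inA c) p = ⊑1R x
  ·R⊑⇒⊑//R (inA a) (inD b) (inD c) ⟪ p ⟫ = ⟪ δc≤δ[δb//a]⇒a≤δc\\δb a b c p ⟫
  ·R⊑⇒⊑//R (inD a) (inD b) (inD c) p = ⟪ tt ⟫
  ·R⊑⇒⊑//R (inL t) (inD b) (inD c) p = ⟪ tt ⟫
  ·R⊑⇒⊑//R x (inD b) (inL j) p = ⊑1R x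
  ·R⊑⇒⊑//R x (inL i) (inA c) p = ⊑1R x
  ·R⊑⇒⊑//R (inA a) (inL i) (inD c) ⟪ () ⟫
  ·R⊑⇒⊑//R (inD b) (inL i) (inD c) p = inD⊑ℓR b _ (1≤κ∸level i)
  ·R⊑⇒⊑//R (inL t) (inL i) (inD c) p =
    level≤⇒inL⊑ℓR t _ (m+n∸o≡0⇒n≤o∸m (level t) (level≤κ i) (ℓR⊑inD⇒≡0 _ c (⊑-respˡ-≡ (ℓR-+-comm t i) p)))
  ·R⊑⇒⊑//R (inA a) (inL i) (inL j) ⟪ lift p ⟫ = κ≤⇒inA⊑ℓR a _ (m≤p⇒o≤o∸m+p (level j) (level≤κ i) (s≤s p))
  ·R⊑⇒⊑//R (inD b) (inL i) (inL j) p = inD⊑ℓR b _ (1≤n+level j (κ ∸ level i))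
  ·R⊑⇒⊑//R (inL t) (inL i) (inL j) p =
    level≤⇒inL⊑ℓR t _
      (m+n∸o≤p⇒n≤o∸m+p (level t) (level j) (level≤κ i) (ℓR⊑inL⇒≤level _ j (⊑-respˡ-≡ (ℓR-+-comm t i) p)))

  ⊑//R⇒·R⊑ : ∀ x y z → x ⊑ (z //R y) → (x ·R y) ⊑ z
  ⊑//R⇒·R⊑ (inA b) (inA a) (inA c) ⟪ p ⟫ = ⟪ resʳ₂ b a c p ⟫
  ⊑//R⇒·R⊑ (inD b) (inA a) (inA c) p = ⟪ tt ⟫
  ⊑//R⇒·R⊑ (inL t) (inA a) (inA c) p = ⟪ tt ⟫
  ⊑//R⇒·R⊑ (inA b) (inA a) (inD c) ⟪ () ⟫
  ⊑//R⇒·R⊑ (inD b) (inA a) (inD c) ⟪ p ⟫ = ⟪ δ[a·c]≤δb⇒δc≤δ[a\\δb] a b c p ⟫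
  ⊑//R⇒·R⊑ (inL t) (inA a) (inD c) ⟪ () ⟫
  ⊑//R⇒·R⊑ (inA b) (inA a) (inL j) ⟪ () ⟫
  ⊑//R⇒·R⊑ (inD b) (inA a) (inL j) p = ⟪ tt ⟫
  ⊑//R⇒·R⊑ (inL t) (inA a) (inL j) p = p
  ⊑//R⇒·R⊑ (inA a) (inD b) (inA c) p = ⟪ tt ⟫
  ⊑//R⇒·R⊑ (inD a) (inD b) (inA c) p = ⟪ tt ⟫
  ⊑//R⇒·R⊑ (inL t) (inD b) (inA c) p = ⟪ tt ⟫
  ⊑//R⇒·R⊑ (inA a) (inD b) (inD c) ⟪ p ⟫ = ⟪ a≤δc\\δb⇒δc≤δ[δb//a] a b c p ⟫
  ⊑//R⇒·R⊑ (inD a) (inD b) (inD c) p = 0R⊑ _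
  ⊑//R⇒·R⊑ (inL t) (inD b) (inD c) p = 0R⊑ _
  ⊑//R⇒·R⊑ (inA a) (inD b) (inL j) p = ⟪ tt ⟫
  ⊑//R⇒·R⊑ (inD a) (inD b) (inL j) p = ⟪ tt ⟫
  ⊑//R⇒·R⊑ (inL t) (inD b) (inL j) p = ⟪ tt ⟫
  ⊑//R⇒·R⊑ (inA a) (inL i) (inA c) p = ⟪ tt ⟫
  ⊑//R⇒·R⊑ (inD a) (inL i) (inA c) p = ⟪ tt ⟫
  ⊑//R⇒·R⊑ (inL t) (inL i) (inA c) p = ℓR⊑inA _ c (level+level∸κ≤k t i)
  ⊑//R⇒·R⊑ (inA a) (inL i) (inD c) p = ⊥-elim (ℕₚ.<⇒≱ (s≤s (κ∸level≤k i)) (inA⊑ℓR⇒κ≤ a _ p))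
  ⊑//R⇒·R⊑ (inD b) (inL i) (inD c) p = 0R⊑ _
  ⊑//R⇒·R⊑ (inL t) (inL i) (inD c) p =
    ⊑-respˡ-≡ (≡.sym (ℓR-+-comm t i))
      (⊑-respˡ-≡ (≡.cong ℓR (≡.sym (n≤o∸m⇒m+n∸o≡0 (level t) (level≤κ i) (inL⊑ℓR⇒level≤ t _ p)))) (0R⊑ _))
  ⊑//R⇒·R⊑ (inA a) (inL i) (inL j) p = ⟪ lift (s≤s⁻¹ (o≤o∸m+p⇒m≤p (level j) (level≤κ i) (inA⊑ℓR⇒κ≤ a _ p))) ⟫
  ⊑//R⇒·R⊑ (inD b) (inL i) (inL j) p = 0R⊑ _
  ⊑//R⇒·R⊑ (inL t) (inL i) (inL j) p =
    ⊑-respˡ-≡ (≡.sym (ℓR-+-comm t i))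
      (≤level⇒ℓR⊑inL _ j (n≤o∸m+p⇒m+n∸o≤p (level t) (level j) (level≤κ i) (inL⊑ℓR⇒level≤ t _ p)))

  ·R-monoˡ : ∀ {x x'} y → x ⊑ x' → (x ·R y) ⊑ (x' ·R y)
  ·R-monoˡ {x} {x'} y p = ⊑//R⇒·R⊑ x y _ (⊑-trans p (·R⊑⇒⊑//R x' y _ ⊑-refl))

  ·R-monoʳ : ∀ x {y y'} → y ⊑ y' → (x ·R y) ⊑ (x ·R y')
  ·R-monoʳ x {y} {y'} p = ⊑\\R⇒·R⊑ x y _ (⊑-trans p (·R⊑⇒⊑\\R x y' _ ⊑-refl))

  ·R-cong : ∀ {x x' y y'} → x ≈R x' → y ≈R y' → (x ·R y) ≈R (x' ·R y')
  ·R-cong {x} {x'} {y} {y'} (p , p') (q , q') =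
    ⊑-trans (·R-monoˡ y p) (·R-monoʳ x' q) , ⊑-trans (·R-monoˡ y' p') (·R-monoʳ x q')

  a\\δε≈ε : ∀ a → (a \\ δ ε) ≈ ε
  a\\δε≈ε a = ≤-antisym (integral _) (resˡ₁ _ _ _ (≤-trans (≤-reflexive (identityʳ a)) (≤-trans (integral a) (extensive ε))))

  δε//a≈ε : ∀ a → (δ ε // a) ≈ ε
  δε//a≈ε a = ≤-antisym (integral _) (resʳ₁ _ _ _ (≤-trans (≤-reflexive (identityˡ a)) (≤-trans (integral a) (extensive ε))))

  inD[a\\δε]≈0R : ∀ a → inD (a \\ δ ε) ≈R 0R
  inD[a\\δε]≈0R a = inD-≈ (δ-cong (a\\δε≈ε a))

  inD[δε//a]≈0R : ∀ a → inD (δ ε // a) ≈R 0R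
  inD[δε//a]≈0R a = inD-≈ (δ-cong (δε//a≈ε a))

  ·R-identityˡ : ∀ x → (1R ·R x) ≈R x
  ·R-identityˡ (inA a) = inA-≈ (identityˡ a)
  ·R-identityˡ (inD b) = inD-≈ (≈-trans (δ[δb//a]≈δb//a b ε) (x//ε≈x (δ b)))
  ·R-identityˡ (inL i) = ≈R-refl

  ·R-identityʳ : ∀ x → (x ·R 1R) ≈R x
  ·R-identityʳ (inA a) = inA-≈ (identityʳ a)
  ·R-identityʳ (inD b) = inD-≈ (≈-trans (δ[a\\δb]≈a\\δb b ε) (ε\\x≈x (δ b)))
  ·R-identityʳ (inL i) = ≈R-refl

  inA·ℓR≈ℓR : ∀ a n → n Nat.≤ k → (inA a ·R ℓR n) ≈R ℓR n
  inA·ℓR≈ℓR a n n≤k with levelView n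
  ... | bottom = inD[δε//a]≈0R a
  ... | middle i rewrite ℓR-level i = ≈R-refl
  ... | above κ≤n = ⊥-elim (ℕₚ.<⇒≱ κ≤n n≤k)

  ℓR·inA≈ℓR : ∀ a n → n Nat.≤ k → (ℓR n ·R inA a) ≈R ℓR n
  ℓR·inA≈ℓR a n n≤k with levelView n
  ... | bottom = inD[a\\δε]≈0R a
  ... | middle i rewrite ℓR-level i = ≈R-refl
  ... | above κ≤n = ⊥-elim (ℕₚ.<⇒≱ κ≤n n≤k)

  inD·ℓR≈0R : ∀ b n → n Nat.≤ k → (inD b ·R ℓR n) ≈R 0R
  inD·ℓR≈0R b n n≤k with levelView n
  ... | bottom = ≈R-refl
  ... | middle i rewrite ℓR-level i = ≈R-refl
  ... | above κ≤n = ⊥-elim (ℕₚ.<⇒≱ κ≤n n≤k)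

  ℓR·inD≈0R : ∀ b n → n Nat.≤ k → (ℓR n ·R inD b) ≈R 0R
  ℓR·inD≈0R b n n≤k with levelView n
  ... | bottom = ≈R-refl
  ... | middle i rewrite ℓR-level i = ≈R-refl
  ... | above κ≤n = ⊥-elim (ℕₚ.<⇒≱ κ≤n n≤k)

  ℓR·inL≈ℓR : ∀ t n → n Nat.≤ k → (ℓR n ·R inL t) ≈R ℓR (n + level t ∸ κ)
  ℓR·inL≈ℓR t n n≤k with levelView n
  ... | bottom = ≈R-reflexive (≡.cong ℓR (≡.sym (ℕₚ.m≤n⇒m∸n≡0 (level≤κ t))))
  ... | middle i rewrite ℓR-level i = ≈R-refl
  ... | above κ≤n = ⊥-elim (ℕₚ.<⇒≱ κ≤n n≤k)

  inL·ℓR≈ℓR : ∀ i n → n Nat.≤ k → (inL i ·R ℓR n) ≈R ℓR (level i + n ∸ κ)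
  inL·ℓR≈ℓR i n n≤k with levelView n
  ... | bottom = ≈R-reflexive (≡.cong ℓR (≡.sym
                   (≡.trans (≡.cong (_∸ κ) (ℕₚ.+-identityʳ (level i))) (ℕₚ.m≤n⇒m∸n≡0 (level≤κ i)))))
  ... | middle t rewrite ℓR-level t = ≈R-refl
  ... | above κ≤n = ⊥-elim (ℕₚ.<⇒≱ κ≤n n≤k)

  ·R-assoc : ∀ x y z → ((x ·R y) ·R z) ≈R (x ·R (y ·R z))
  ·R-assoc (inA a) (inA b) (inA c) = inA-≈ (assoc a b c)
  ·R-assoc (inA a) (inA b) (inD c) = inD-≈ (≈-trans (δ[δb//a]≈δb//a c (a · b))
      (≈-trans (≈-sym (//-// (δ c) a b))
      (≈-trans (//-cong (≈-sym (δ[δb//a]≈δb//a c b)) ≈-refl) (≈-sym (δ[δb//a]≈δb//a (δ c // b) a)))))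
  ·R-assoc (inA a) (inA b) (inL c) = ≈R-refl
  ·R-assoc (inA a) (inD b) (inA c) = inD-≈ (≈-trans (δ[a\\δb]≈a\\δb (δ b // a) c)
      (≈-trans (\\-cong ≈-refl (δ[δb//a]≈δb//a b a))
      (≈-trans (≈-sym (\\-//-comm c (δ b) a))
      (≈-trans (//-cong (≈-sym (δ[a\\δb]≈a\\δb b c)) ≈-refl) (≈-sym (δ[δb//a]≈δb//a (c \\ δ b) a))))))
  ·R-assoc (inA a) (inD b) (inD c) = ≈R-sym (inD[δε//a]≈0R a)
  ·R-assoc (inA a) (inD b) (inL c) = ≈R-sym (inD[δε//a]≈0R a)
  ·R-assoc (inA a) (inL i) (inA c) = ≈R-refl
  ·R-assoc (inA a) (inL i) (inD c) = ≈R-sym (inD[δε//a]≈0R a)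
  ·R-assoc (inA a) (inL i) (inL j) = ≈R-sym (inA·ℓR≈ℓR a _ (level+level∸κ≤k i j))
  ·R-assoc (inD b) (inA a) (inA c) = inD-≈ (≈-trans (δ[a\\δb]≈a\\δb (a \\ δ b) c)
      (≈-trans (\\-cong ≈-refl (δ[a\\δb]≈a\\δb b a))
      (≈-trans (\\-\\ (δ b) c a) (≈-sym (δ[a\\δb]≈a\\δb b (a · c))))))
  ·R-assoc (inD b) (inA a) (inD c) = ≈R-refl
  ·R-assoc (inD b) (inA a) (inL c) = ≈R-refl
  ·R-assoc (inD b) (inD d) (inA a) = inD[a\\δε]≈0R a
  ·R-assoc (inD b) (inD d) (inD c) = ≈R-refl
  ·R-assoc (inD b) (inD d) (inL c) = ≈R-refl
  ·R-assoc (inD b) (inL i) (inA a) = inD[a\\δε]≈0R a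
  ·R-assoc (inD b) (inL i) (inD c) = ≈R-refl
  ·R-assoc (inD b) (inL i) (inL j) = ≈R-sym (inD·ℓR≈0R b _ (level+level∸κ≤k i j))
  ·R-assoc (inL i) (inA a) (inA c) = ≈R-refl
  ·R-assoc (inL i) (inA a) (inD c) = ≈R-refl
  ·R-assoc (inL i) (inA a) (inL j) = ≈R-refl
  ·R-assoc (inL i) (inD b) (inA a) = inD[a\\δε]≈0R a
  ·R-assoc (inL i) (inD b) (inD c) = ≈R-refl
  ·R-assoc (inL i) (inD b) (inL j) = ≈R-refl
  ·R-assoc (inL i) (inL j) (inA a) = ℓR·inA≈ℓR a _ (level+level∸κ≤k i j)
  ·R-assoc (inL i) (inL j) (inD c) = ℓR·inD≈0R c _ (level+level∸κ≤k i j)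
  ·R-assoc (inL i) (inL j) (inL t) =
    ≈R-trans (ℓR·inL≈ℓR t _ (level+level∸κ≤k i j))
    (≈R-trans (≈R-reflexive (≡.cong ℓR ([m+n∸o]+p∸o≡m+[n+p∸o]∸o (level i) (level j) (level t) (level≤κ i) (level≤κ t))))
    (≈R-sym (inL·ℓR≈ℓR i _ (level+level∸κ≤k j t))))

  ≈R-isEquivalence : IsEquivalence _≈R_
  ≈R-isEquivalence = record { refl = ≈R-refl ; sym = ≈R-sym ; trans = ≈R-trans }

  ≈R-setoid : Setoid c ℓ
  ≈R-setoid = record { isEquivalence = ≈R-isEquivalence }

  module ≈R-Reasoning = SetoidReasoning ≈R-setoid

  ⊑-isPartialOrder : IsPartialOrder _≈R_ _⊑_
  ⊑-isPartialOrder = record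
    { isPreorder = record { isEquivalence = ≈R-isEquivalence ; reflexive = proj₁ ; trans = ⊑-trans }
    ; antisym = _,_ }

  ⊑-isLattice : OrderLattice.IsLattice _≈R_ _⊑_ _∨R_ _∧R_
  ⊑-isLattice = record
    { isPartialOrder = ⊑-isPartialOrder
    ; supremum = λ x y → x⊑x∨Ry x y , y⊑x∨Ry x y , λ z p q → ∨R-least p q
    ; infimum = λ x y → x∧Ry⊑x x y , x∧Ry⊑y x y , λ z p q → ∧R-greatest p q }

  ⊑-lattice : OrderLattice.Lattice c ℓ ℓ
  ⊑-lattice = record { isLattice = ⊑-isLattice }

  \\R-cong : ∀ {x x' z z'} → x ≈R x' → z ≈R z' → (x \\R z) ≈R (x' \\R z')
  \\R-cong {x} {x'} {z} {z'} (p , p') (q , q') =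
    ·R⊑⇒⊑\\R x' _ z' (⊑-trans (·R-monoˡ _ p') (⊑-trans (⊑\\R⇒·R⊑ x _ z ⊑-refl) q)) ,
    ·R⊑⇒⊑\\R x _ z (⊑-trans (·R-monoˡ _ p) (⊑-trans (⊑\\R⇒·R⊑ x' _ z' ⊑-refl) q'))

  //R-cong : ∀ {z z' x x'} → z ≈R z' → x ≈R x' → (z //R x) ≈R (z' //R x')
  //R-cong {z} {z'} {x} {x'} (q , q') (p , p') =
    ·R⊑⇒⊑//R _ x' z' (⊑-trans (·R-monoʳ (z //R x) p') (⊑-trans (⊑//R⇒·R⊑ _ x z ⊑-refl) q)) ,
    ·R⊑⇒⊑//R _ x z (⊑-trans (·R-monoʳ (z' //R x') p) (⊑-trans (⊑//R⇒·R⊑ _ x' z' ⊑-refl) q'))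

  x⊑y⇒x∧Ry≈x : ∀ {x y} → x ⊑ y → (x ∧R y) ≈R x
  x⊑y⇒x∧Ry≈x {x} {y} p = x∧Ry⊑x x y , ∧R-greatest ⊑-refl p

  x∧Ry≈x⇒x⊑y : ∀ {x y} → (x ∧R y) ≈R x → x ⊑ y
  x∧Ry≈x⇒x⊑y {x} {y} e = ⊑-trans (proj₂ e) (x∧Ry⊑y x y)

  rotationRL : RL c ℓ
  rotationRL = record
    { Carrier = R
    ; _≈_ = _≈R_
    ; _∧_ = _∧R_
    ; _∨_ = _∨R_
    ; _·_ = _·R_
    ; _\\_ = _\\R_
    ; _//_ = _//R_
    ; ε = 1R
    ; isLattice = OrderLatticeProperties.isAlgLattice ⊑-lattice
    ; isMonoid = record
      { isSemigroup = record
        { isMagma = record { isEquivalence = ≈R-isEquivalence ; ∙-cong = ·R-cong }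
        ; assoc = ·R-assoc }
      ; identity = ·R-identityˡ , ·R-identityʳ }
    ; \\-cong = \\R-cong
    ; //-cong = //R-cong
    ; resˡ₁ = λ x y z p → x⊑y⇒x∧Ry≈x (·R⊑⇒⊑\\R x y z (x∧Ry≈x⇒x⊑y p))
    ; resˡ₂ = λ x y z p → x⊑y⇒x∧Ry≈x (⊑\\R⇒·R⊑ x y z (x∧Ry≈x⇒x⊑y p))
    ; resʳ₁ = λ x y z p → x⊑y⇒x∧Ry≈x (·R⊑⇒⊑//R x y z (x∧Ry≈x⇒x⊑y p))
    ; resʳ₂ = λ x y z p → x⊑y⇒x∧Ry≈x (⊑//R⇒·R⊑ x y z (x∧Ry≈x⇒x⊑y p))
    }

  rotationFL : FL c ℓ
  rotationFL = record { rl = rotationRL ; zer = 0R }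

  levelOf : ∀ {n} → 1 Nat.≤ n → n Nat.≤ k → Σ (Fin k) λ i → level i ≡ n
  levelOf {n} 1≤n n≤k with levelView n
  ... | bottom = ⊥-elim (ℕₚ.n≮0 1≤n)
  ... | middle i = i , refl
  ... | above κ≤n = ⊥-elim (ℕₚ.<⇒≱ κ≤n n≤k)

  ℓR-mono : ∀ {n n'} → n Nat.≤ n' → ℓR n ⊑ ℓR n'
  ℓR-mono {n} {n'} n≤n' with levelView n
  ... | bottom = 0R⊑ _
  ... | middle i rewrite ℓR-level i = level≤⇒inL⊑ℓR i n' n≤n'
  ... | above κ≤n rewrite ℓR-≥κ κ≤n | ℓR-≥κ (ℕₚ.≤-trans κ≤n n≤n') = ⊑-refl

  ℓR⊑ℓR⇒≤ : ∀ {n n'} → 1 Nat.≤ n → n Nat.≤ k → ℓR n ⊑ ℓR n' → n Nat.≤ n'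
  ℓR⊑ℓR⇒≤ {n} {n'} 1≤n n≤k r with levelOf 1≤n n≤k
  ... | i , refl rewrite ℓR-level i = inL⊑ℓR⇒level≤ i n' r

  inL-total : ∀ i j → inL i ⊑ inL j ⊎ inL j ⊑ inL i
  inL-total i j with Finₚ.≤-total i j
  ... | inj₁ i≤j = inj₁ ⟪ lift i≤j ⟫
  ... | inj₂ j≤i = inj₂ ⟪ lift j≤i ⟫

  ∧R-comm : ∀ x y → (x ∧R y) ≈R (y ∧R x)
  ∧R-comm x y = ∧R-greatest (x∧Ry⊑y x y) (x∧Ry⊑x x y) , ∧R-greatest (x∧Ry⊑y y x) (x∧Ry⊑x y x)

  ∨R-comm : ∀ x y → (x ∨R y) ≈R (y ∨R x)
  ∨R-comm x y = ∨R-least (y⊑x∨Ry y x) (x⊑x∨Ry y x) , ∨R-least (y⊑x∨Ry x y) (x⊑x∨Ry x y)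

  x⊑y⇒y∧Rx≈x : ∀ {x y} → x ⊑ y → (y ∧R x) ≈R x
  x⊑y⇒y∧Rx≈x {x} {y} p = ≈R-trans (∧R-comm y x) (x⊑y⇒x∧Ry≈x p)
  x⊑y⇒x∨Ry≈y : ∀ {x y} → x ⊑ y → (x ∨R y) ≈R y
  x⊑y⇒x∨Ry≈y {x} {y} p = ∨R-least p ⊑-refl , y⊑x∨Ry x y
  x⊑y⇒y∨Rx≈y : ∀ {x y} → x ⊑ y → (y ∨R x) ≈R y
  x⊑y⇒y∨Rx≈y {x} {y} p = ≈R-trans (∨R-comm y x) (x⊑y⇒x∨Ry≈y p)

  inA\\ℓR≈ℓR : ∀ a n → 1 Nat.≤ n → n Nat.≤ k → (inA a \\R ℓR n) ≈R ℓR n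
  inA\\ℓR≈ℓR a n 1≤n n≤k with levelOf 1≤n n≤k
  ... | i , refl rewrite ℓR-level i = ≈R-refl

  ℓR//inA≈ℓR : ∀ a n → 1 Nat.≤ n → n Nat.≤ k → (ℓR n //R inA a) ≈R ℓR n
  ℓR//inA≈ℓR a n 1≤n n≤k with levelOf 1≤n n≤k
  ... | i , refl rewrite ℓR-level i = ≈R-refl

  inD\\ℓR≈1R : ∀ b n → 1 Nat.≤ n → (inD b \\R ℓR n) ≈R 1R
  inD\\ℓR≈1R b n 1≤n with levelView n
  ... | bottom = ⊥-elim (ℕₚ.n≮0 1≤n)
  ... | middle i rewrite ℓR-level i = ≈R-refl
  ... | above κ≤n rewrite ℓR-≥κ κ≤n = ≈R-refl

  ℓR//inD≈1R : ∀ b n → 1 Nat.≤ n → (ℓR n //R inD b) ≈R 1R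
  ℓR//inD≈1R b n 1≤n with levelView n
  ... | bottom = ⊥-elim (ℕₚ.n≮0 1≤n)
  ... | middle i rewrite ℓR-level i = ≈R-refl
  ... | above κ≤n rewrite ℓR-≥κ κ≤n = ≈R-refl

  ℓR\\inA≈1R : ∀ c n → n Nat.≤ k → (ℓR n \\R inA c) ≈R 1R
  ℓR\\inA≈1R c n n≤k with levelView n
  ... | bottom = ≈R-refl
  ... | middle i rewrite ℓR-level i = ≈R-refl
  ... | above κ≤n = ⊥-elim (ℕₚ.<⇒≱ κ≤n n≤k)

  inA//ℓR≈1R : ∀ c n → n Nat.≤ k → (inA c //R ℓR n) ≈R 1R
  inA//ℓR≈1R c n n≤k with levelView n
  ... | bottom = ≈R-refl
  ... | middle i rewrite ℓR-level i = ≈R-refl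
  ... | above κ≤n = ⊥-elim (ℕₚ.<⇒≱ κ≤n n≤k)

  ℓR·ℓR≈ℓR : ∀ n n' → 1 Nat.≤ n → n Nat.≤ k → n' Nat.≤ k → (ℓR n ·R ℓR n') ≈R ℓR (n + n' ∸ κ)
  ℓR·ℓR≈ℓR n n' 1≤n n≤k n'≤k with levelOf 1≤n n≤k
  ... | i , refl rewrite ℓR-level i = inL·ℓR≈ℓR i n' n'≤k

  ℓR\\inD≈ℓR : ∀ n c → 1 Nat.≤ n → n Nat.≤ k → (ℓR n \\R inD c) ≈R ℓR (κ ∸ n)
  ℓR\\inD≈ℓR n c 1≤n n≤k with levelOf 1≤n n≤k
  ... | i , refl rewrite ℓR-level i = ≈R-refl

  inD//ℓR≈ℓR : ∀ n c → 1 Nat.≤ n → n Nat.≤ k → (inD c //R ℓR n) ≈R ℓR (κ ∸ n)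
  inD//ℓR≈ℓR n c 1≤n n≤k with levelOf 1≤n n≤k
  ... | i , refl rewrite ℓR-level i = ≈R-refl

  inL\\ℓR≈ℓR : ∀ i n → n Nat.≤ k → (inL i \\R ℓR n) ≈R ℓR (κ ∸ level i + n)
  inL\\ℓR≈ℓR i n n≤k with levelView n
  ... | bottom = ≈R-reflexive (≡.cong ℓR (≡.sym (ℕₚ.+-identityʳ (κ ∸ level i))))
  ... | middle j rewrite ℓR-level j = ≈R-refl
  ... | above κ≤n = ⊥-elim (ℕₚ.<⇒≱ κ≤n n≤k)

  ℓR//inL≈ℓR : ∀ i n → n Nat.≤ k → (ℓR n //R inL i) ≈R ℓR (κ ∸ level i + n)
  ℓR//inL≈ℓR i n n≤k with levelView n
  ... | bottom = ≈R-reflexive (≡.cong ℓR (≡.sym (ℕₚ.+-identityʳ (κ ∸ level i))))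
  ... | middle j rewrite ℓR-level j = ≈R-refl
  ... | above κ≤n = ⊥-elim (ℕₚ.<⇒≱ κ≤n n≤k)

  ℓR\\ℓR≈ℓR : ∀ n n' → 1 Nat.≤ n → n Nat.≤ k → n' Nat.≤ k → (ℓR n \\R ℓR n') ≈R ℓR (κ ∸ n + n')
  ℓR\\ℓR≈ℓR n n' 1≤n n≤k n'≤k with levelOf 1≤n n≤k
  ... | i , refl rewrite ℓR-level i = inL\\ℓR≈ℓR i n' n'≤k

  ℓR//ℓR≈ℓR : ∀ n' n → 1 Nat.≤ n → n Nat.≤ k → n' Nat.≤ k → (ℓR n' //R ℓR n) ≈R ℓR (κ ∸ n + n')
  ℓR//ℓR≈ℓR n' n 1≤n n≤k n'≤k with levelOf 1≤n n≤k
  ... | i , refl rewrite ℓR-level i = ℓR//inL≈ℓR i n' n'≤k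

  ℓR[1+n]\\ℓR[n]≈ℓR[k] : ∀ n → n Nat.< k → (ℓR (suc n) \\R ℓR n) ≈R ℓR k
  ℓR[1+n]\\ℓR[n]≈ℓR[k] n n<k = begin
    ℓR (suc n) \\R ℓR n ≈⟨ ℓR\\ℓR≈ℓR (suc n) n (s≤s z≤n) n<k (ℕₚ.<⇒≤ n<k) ⟩
    ℓR (k ∸ n + n)      ≈⟨ ≈R-reflexive (≡.cong ℓR (ℕₚ.m∸n+n≡m (ℕₚ.<⇒≤ n<k))) ⟩
    ℓR k                ∎
    where open ≈R-Reasoning

  ℓR≈inL⇒≡level : ∀ n j → ℓR n ≈R inL j → n ≡ level j
  ℓR≈inL⇒≡level n j (p , q) = ℕₚ.≤-antisym (ℓR⊑inL⇒≤level n j p) (inL⊑ℓR⇒level≤ j n q)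

  ℓR-injective : ∀ {n n'} → 1 Nat.≤ n → n Nat.≤ k → ℓR n ≈R ℓR n' → n ≡ n'
  ℓR-injective {n} {n'} 1≤n n≤k e with levelOf 1≤n n≤k
  ... | i , refl rewrite ℓR-level i = ≡.sym (ℓR≈inL⇒≡level n' i (≈R-sym e))

  InA : R → Set c
  InA x = Σ Carrier λ a → x ≡ inA a

  ≈inA⇒InA : ∀ {x a} → x ≈R inA a → InA x
  ≈inA⇒InA {inA b} _ = b , refl
  ≈inA⇒InA {inD b} (_ , ⟪ () ⟫)
  ≈inA⇒InA {inL j} (_ , ⟪ () ⟫)

  x·Ry≈Ry⇒y⊑0R⊎InA : ∀ x y → (x ·R y) ≈R y → y ⊑ 0R ⊎ InA x
  x·Ry≈Ry⇒y⊑0R⊎InA (inA a) y e = inj₂ (a , refl)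
  x·Ry≈Ry⇒y⊑0R⊎InA (inD b) (inA c) (_ , ⟪ () ⟫)
  x·Ry≈Ry⇒y⊑0R⊎InA (inD b) (inD c) (_ , q) = inj₁ q
  x·Ry≈Ry⇒y⊑0R⊎InA (inD b) (inL t) (_ , ⟪ () ⟫)
  x·Ry≈Ry⇒y⊑0R⊎InA (inL j) (inA c) (_ , ⟪ () ⟫)
  x·Ry≈Ry⇒y⊑0R⊎InA (inL j) (inD c) (_ , q) = inj₁ q
  x·Ry≈Ry⇒y⊑0R⊎InA (inL j) (inL t) (_ , q) = ⊥-elim (ℕₚ.<⇒≱ j·t<t (inL⊑ℓR⇒level≤ t _ q))
    where
    j·t<t : level j + level t ∸ κ Nat.< level t
    j·t<t = s≤s (ℕₚ.≤-trans (ℕₚ.∸-monoˡ-≤ κ (ℕₚ.+-monoˡ-≤ (level t) (level≤k j)))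
                            (ℕₚ.≤-reflexive (m+n∸[1+m]≡n∸1 k (level t))))

  infixr 8 _^R_
  _^R_ : R → ℕ → R
  x ^R zero = 1R
  x ^R suc n = x ·R (x ^R n)

  inL^[1+n]⊑ℓR : ∀ i n → inL i ^R suc n ⊑ ℓR (κ ∸ suc n)
  inL^[1+n]⊑ℓR i zero = level≤⇒inL⊑ℓR i k (level≤k i)
  inL^[1+n]⊑ℓR i (suc n) = ⊑-trans (·R-monoʳ (inL i) (inL^[1+n]⊑ℓR i n))
    (⊑-trans (proj₁ (inL·ℓR≈ℓR i (k ∸ n) (ℕₚ.m∸n≤m k n)))
      (ℓR-mono (m≤o⇒m+[o∸n]∸[1+o]≤o∸[1+n] n (level≤k i))))

  inL^κ≈0R : ∀ i → inL i ^R κ ≈R 0R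
  inL^κ≈0R i = ⊑-respʳ-≡ (≡.cong ℓR (ℕₚ.n∸n≡0 κ)) (inL^[1+n]⊑ℓR i k) , 0R⊑ _

  inA^n≡inA : ∀ a n → Σ Carrier λ b → inA a ^R n ≡ inA b
  inA^n≡inA a zero = ε , refl
  inA^n≡inA a (suc n) with inA^n≡inA a n
  ... | b , e rewrite e = a · b , refl

module _ {c ℓ c' ℓ'} {A : RL c ℓ} {B : RL c' ℓ'} (e : RLEmb A B) where
  private
    module A = RL A
    module B = RL B
    module B' = RLProperties B
    open RLEmb e

  RLEmb-mono : ∀ {x y} → x A.≤ y → fun x B.≤ fun y
  RLEmb-mono {x} {y} p = B'.≈-trans (B'.≈-sym (pres-∧ x y)) (cong p)

  RLEmb-reflects-≤ : ∀ {x y} → fun x B.≤ fun y → x A.≤ y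
  RLEmb-reflects-≤ {x} {y} p = inj (B'.≈-trans (pres-∧ x y) p)

RLEmb-∘ : ∀ {c ℓ} {A B C : RL c ℓ} → RLEmb B C → RLEmb A B → RLEmb A C
RLEmb-∘ {C = C} g f = record
  { fun     = λ x → G.fun (F.fun x)
  ; cong    = λ e → G.cong (F.cong e)
  ; inj     = λ e → F.inj (G.inj e)
  ; pres-∧  = λ x y → C'.≈-trans (G.cong (F.pres-∧ x y)) (G.pres-∧ _ _)
  ; pres-∨  = λ x y → C'.≈-trans (G.cong (F.pres-∨ x y)) (G.pres-∨ _ _)
  ; pres-·  = λ x y → C'.≈-trans (G.cong (F.pres-· x y)) (G.pres-· _ _)
  ; pres-\\ = λ x y → C'.≈-trans (G.cong (F.pres-\\ x y)) (G.pres-\\ _ _)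
  ; pres-// = λ x y → C'.≈-trans (G.cong (F.pres-// x y)) (G.pres-// _ _)
  ; pres-ε  = C'.≈-trans (G.cong F.pres-ε) G.pres-ε
  }
  where
  module G = RLEmb g
  module F = RLEmb f
  module C' = RLProperties C

FLEmb-∘ : ∀ {c ℓ} {A B C : FL c ℓ} → FLEmb B C → FLEmb A B → FLEmb A C
FLEmb-∘ {C = C} g f = record
  { emb    = RLEmb-∘ (FLEmb.emb g) (FLEmb.emb f)
  ; pres-0 = RLProperties.≈-trans (FL.rl C) (RLEmb.cong (FLEmb.emb g) (FLEmb.pres-0 f)) (FLEmb.pres-0 g)
  }

RLEmb-eval : ∀ {c ℓ} {A B : RL c ℓ} (h : RLEmb A B) t x →
             RL._≈_ B (RLEmb.fun h (eval A t x)) (eval B t (RLEmb.fun h x))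
RLEmb-eval {B = B} h var       x = RLProperties.≈-refl B
RLEmb-eval {B = B} h one       x = RLEmb.pres-ε h
RLEmb-eval {B = B} h (s ∧ₜ t)  x = RLProperties.≈-trans B (RLEmb.pres-∧ h _ _) (RLProperties.∧-cong B (RLEmb-eval h s x) (RLEmb-eval h t x))
RLEmb-eval {B = B} h (s ∨ₜ t)  x = RLProperties.≈-trans B (RLEmb.pres-∨ h _ _) (RLProperties.∨-cong B (RLEmb-eval h s x) (RLEmb-eval h t x))
RLEmb-eval {B = B} h (s ·ₜ t)  x = RLProperties.≈-trans B (RLEmb.pres-· h _ _) (RLProperties.·-cong B (RLEmb-eval h s x) (RLEmb-eval h t x))
RLEmb-eval {B = B} h (s \\ₜ t) x = RLProperties.≈-trans B (RLEmb.pres-\\ h _ _) (RL.\\-cong B (RLEmb-eval h s x) (RLEmb-eval h t x))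
RLEmb-eval {B = B} h (s //ₜ t) x = RLProperties.≈-trans B (RLEmb.pres-// h _ _) (RL.//-cong B (RLEmb-eval h s x) (RLEmb-eval h t x))

module SurjectiveEmbedding {c ℓ} {A B : RL c ℓ} (e : RLEmb A B)
                           (surjective : ∀ b → Σ (RL.Carrier A) λ a → RL._≈_ B (RLEmb.fun e a) b) where
  private
    module A = RL A
    module B = RL B
    module B' = RLProperties B
    open RLEmb e

  inverse : B.Carrier → A.Carrier
  inverse b = proj₁ (surjective b)

  fun-inverse : ∀ b → fun (inverse b) B.≈ b
  fun-inverse b = proj₂ (surjective b)

  private
    pres : ∀ (_∙ᴬ_ : A.Carrier → A.Carrier → A.Carrier) (_∙ᴮ_ : B.Carrier → B.Carrier → B.Carrier) →
           (∀ x y → fun (x ∙ᴬ y) B.≈ (fun x ∙ᴮ fun y)) →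
           (∀ {x x' y y'} → x B.≈ x' → y B.≈ y' → (x ∙ᴮ y) B.≈ (x' ∙ᴮ y')) →
           ∀ b b' → inverse (b ∙ᴮ b') A.≈ (inverse b ∙ᴬ inverse b')
    pres _∙ᴬ_ _∙ᴮ_ fun-∙ ∙ᴮ-cong b b' = inj (B'.≈-trans (fun-inverse _)
      (B'.≈-sym (B'.≈-trans (fun-∙ _ _) (∙ᴮ-cong (fun-inverse b) (fun-inverse b')))))

  inverseEmb : RLEmb B A
  inverseEmb = record
    { fun     = inverse
    ; cong    = λ e → inj (B'.≈-trans (fun-inverse _) (B'.≈-trans e (B'.≈-sym (fun-inverse _))))
    ; inj     = λ e → B'.≈-trans (B'.≈-sym (fun-inverse _)) (B'.≈-trans (cong e) (fun-inverse _))
    ; pres-∧  = pres A._∧_ B._∧_ pres-∧ B'.∧-cong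
    ; pres-∨  = pres A._∨_ B._∨_ pres-∨ B'.∨-cong
    ; pres-·  = pres A._·_ B._·_ pres-· B'.·-cong
    ; pres-\\ = pres A._\\_ B._\\_ pres-\\ B.\\-cong
    ; pres-// = pres A._//_ B._//_ pres-// B.//-cong
    ; pres-ε  = inj (B'.≈-trans (fun-inverse _) (B'.≈-sym pres-ε))
    }

module _ {c ℓ} {A B : RL c ℓ} (φ : RL.Carrier A → RL.Carrier B)
         (φ-mono : ∀ {x y} → RL._≤_ A x y → RL._≤_ B (φ x) (φ y))
         (φ-reflects : ∀ {x y} → RL._≤_ B (φ x) (φ y) → RL._≤_ A x y)
         (φ-surjective : ∀ b → Σ (RL.Carrier A) λ a → RL._≈_ B (φ a) b)
         (φ-· : ∀ x y → RL._≈_ B (φ (RL._·_ A x y)) (RL._·_ B (φ x) (φ y)))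
         (φ-ε : RL._≈_ B (φ (RL.ε A)) (RL.ε B)) where
  private
    module A = RL A
    module B = RL B
    module A' = RLProperties A
    module B' = RLProperties B

    ψ : B.Carrier → A.Carrier
    ψ b = proj₁ (φ-surjective b)

    φψ : ∀ b → φ (ψ b) B.≈ b
    φψ b = proj₂ (φ-surjective b)

    ≤φ⇒ψ≤ : ∀ {x b} → b B.≤ φ x → ψ b A.≤ x
    ≤φ⇒ψ≤ p = φ-reflects (B'.≤-trans (B'.≤-reflexive (φψ _)) p)

    φ≤⇒≤ψ : ∀ {x b} → φ x B.≤ b → x A.≤ ψ b
    φ≤⇒≤ψ p = φ-reflects (B'.≤-trans p (B'.≤-reflexive (B'.≈-sym (φψ _))))

    ≤φψ : ∀ b → b B.≤ φ (ψ b)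
    ≤φψ b = B'.≤-reflexive (B'.≈-sym (φψ b))

  surjectiveOrderEmbedding : RLEmb A B
  surjectiveOrderEmbedding = record
    { fun     = φ
    ; cong    = λ e → B'.≤-antisym (φ-mono (A'.≤-reflexive e)) (φ-mono (A'.≤-reflexive (A'.≈-sym e)))
    ; inj     = λ e → A'.≤-antisym (φ-reflects (B'.≤-reflexive e)) (φ-reflects (B'.≤-reflexive (B'.≈-sym e)))
    ; pres-∧  = λ x y → B'.≤-antisym
        (B'.∧-greatest (φ-mono (A'.x∧y≤x x y)) (φ-mono (A'.x∧y≤y x y)))
        (B'.≤-trans (≤φψ _) (φ-mono (A'.∧-greatest (≤φ⇒ψ≤ (B'.x∧y≤x _ _)) (≤φ⇒ψ≤ (B'.x∧y≤y _ _)))))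
    ; pres-∨  = λ x y → B'.≤-antisym
        (B'.≤-trans (φ-mono (A'.∨-least (φ≤⇒≤ψ (B'.x≤x∨y _ _)) (φ≤⇒≤ψ (B'.y≤x∨y _ _)))) (B'.≤-reflexive (φψ _)))
        (B'.∨-least (φ-mono (A'.x≤x∨y x y)) (φ-mono (A'.y≤x∨y x y)))
    ; pres-·  = φ-·
    ; pres-\\ = λ x y → B'.≤-antisym
        (B.resˡ₁ _ _ _ (B'.≤-trans (B'.≤-reflexive (B'.≈-sym (φ-· x _))) (φ-mono (A'.\\-eval x y))))
        (B'.≤-trans (≤φψ _) (φ-mono (A.resˡ₁ _ _ _ (φ-reflects
          (B'.≤-trans (B'.≤-reflexive (φ-· x _)) (B'.≤-trans (B'.·-monoʳ _ (B'.≤-reflexive (φψ _))) (B'.\\-eval _ _)))))))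
    ; pres-// = λ x y → B'.≤-antisym
        (B.resʳ₁ _ _ _ (B'.≤-trans (B'.≤-reflexive (B'.≈-sym (φ-· _ y))) (φ-mono (A'.//-eval y x))))
        (B'.≤-trans (≤φψ _) (φ-mono (A.resʳ₁ _ _ _ (φ-reflects
          (B'.≤-trans (B'.≤-reflexive (φ-· _ y)) (B'.≤-trans (B'.·-monoˡ _ (B'.≤-reflexive (φψ _))) (B'.//-eval _ _)))))))
    ; pres-ε  = φ-ε
    }

module RotationIsomorphism {c ℓ} (A : IRL c ℓ) (δ : RL.Carrier (IRL.rl A) → RL.Carrier (IRL.rl A))
                           (N : IsNucleus (IRL.rl A) δ) (m : ℕ) where
  open RotationAlgebra A δ N (m ∸ 2)

  isRotation : IsRotation (IRL.rl A) δ m rotationFL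
  isRotation = (λ x → x)
             , (λ x y → (λ p → x⊑y⇒x∧Ry≈x ⟪ p ⟫) , (λ p → out (x∧Ry≈x⇒x⊑y p)))
             , (λ x → x , ≈R-refl)
             , (λ x y → ≈R-refl)
             , ≈R-refl
             , ≈R-refl

  module _ (B : FL c ℓ) (iso : IsRotation (IRL.rl A) δ m B) where
    private
      module B = RL (FL.rl B)
      module B' = RLProperties (FL.rl B)

      φ : R → B.Carrier
      φ = proj₁ iso

      φ-surjective : ∀ b → Σ R λ x → φ x B.≈ b
      φ-surjective = proj₁ (proj₂ (proj₂ iso))

    fromRotation : FLEmb rotationFL B
    fromRotation = record
      { emb    = surjectiveOrderEmbedding φ
                   (λ {x} {y} p → proj₁ (proj₁ (proj₂ iso) x y) (out (x∧Ry≈x⇒x⊑y p)))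
                   (λ {x} {y} p → x⊑y⇒x∧Ry≈x ⟪ proj₂ (proj₁ (proj₂ iso) x y) p ⟫)
                   φ-surjective
                   (proj₁ (proj₂ (proj₂ (proj₂ iso))))
                   (proj₁ (proj₂ (proj₂ (proj₂ (proj₂ iso)))))
      ; pres-0 = proj₂ (proj₂ (proj₂ (proj₂ (proj₂ iso))))
      }

    private
      module S = SurjectiveEmbedding (FLEmb.emb fromRotation) φ-surjective

    toRotation : FLEmb B rotationFL
    toRotation = record
      { emb    = S.inverseEmb
      ; pres-0 = RLEmb.inj (FLEmb.emb fromRotation) (B'.≈-trans (S.fun-inverse _) (B'.≈-sym (FLEmb.pres-0 fromRotation)))
      }

    fromRotation∘toRotation : ∀ b → RLEmb.fun (FLEmb.emb fromRotation) (RLEmb.fun (FLEmb.emb toRotation) b) B.≈ b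
    fromRotation∘toRotation = S.fun-inverse

module RotationExtension {c ℓ : Level}
  (A₀ : IRL c ℓ) (δ₀ : RL.Carrier (IRL.rl A₀) → RL.Carrier (IRL.rl A₀)) (N₀ : IsNucleus (IRL.rl A₀) δ₀) (k₀ : ℕ)
  (A₁ : IRL c ℓ) (δ₁ : RL.Carrier (IRL.rl A₁) → RL.Carrier (IRL.rl A₁)) (N₁ : IsNucleus (IRL.rl A₁) δ₁) (k₁ : ℕ)
  (h : RLEmb (IRL.rl A₀) (IRL.rl A₁))
  (h-δ : ∀ a → RL._≈_ (IRL.rl A₁) (RLEmb.fun h (δ₀ a)) (δ₁ (RLEmb.fun h a)))
  (d : ℕ) (κ₁≡κ₀*d : suc k₁ ≡ suc k₀ * d) where
  module R₀ = RotationAlgebra A₀ δ₀ N₀ k₀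
  module R₁ = RotationAlgebra A₁ δ₁ N₁ k₁
  private
    module A₁ = RL (IRL.rl A₁)
    module A₁' = RLProperties (IRL.rl A₁)
    module N₁' = NucleusProperties (IRL.rl A₁) δ₁ N₁
    open RLEmb h using (fun; pres-∧; pres-∨; pres-·; pres-\\; pres-//; pres-ε)
  open R₁ using (_≈R_; _⊑_; ⟪_⟫; ≈R-refl; ≈R-sym; ≈R-trans)

  κ₀*d≡κ₁ : R₀.κ * d ≡ R₁.κ
  κ₀*d≡κ₁ = ≡.sym κ₁≡κ₀*d

  1≤d : 1 Nat.≤ d
  1≤d = ℕₚ.n≢0⇒n>0 {d} λ d≡0 →
    ℕₚ.1+n≢0 (≡.trans κ₁≡κ₀*d (≡.trans (≡.cong (suc k₀ *_) d≡0) (ℕₚ.*-zeroʳ (suc k₀))))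

  1≤level*d : ∀ i → 1 Nat.≤ R₀.level i * d
  1≤level*d i = ℕₚ.*-mono-≤ {1} {R₀.level i} (s≤s z≤n) 1≤d

  level*d≤k₁ : ∀ i → R₀.level i * d Nat.≤ k₁
  level*d≤k₁ i = s≤s⁻¹ (≡.subst (R₀.level i * d Nat.<_) κ₀*d≡κ₁
    (ℕₚ.*-monoˡ-< d {{Nat.>-nonZero 1≤d}} (s≤s (R₀.level≤k i))))

  [m+n∸κ₀]*d≡m*d+n*d∸κ₁ : ∀ m n → (m + n ∸ R₀.κ) * d ≡ m * d + n * d ∸ R₁.κ
  [m+n∸κ₀]*d≡m*d+n*d∸κ₁ m n = begin
    (m + n ∸ R₀.κ) * d      ≡⟨ ℕₚ.*-distribʳ-∸ d (m + n) R₀.κ ⟩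
    (m + n) * d ∸ R₀.κ * d  ≡⟨ ≡.cong₂ _∸_ (ℕₚ.*-distribʳ-+ d m n) κ₀*d≡κ₁ ⟩
    m * d + n * d ∸ R₁.κ    ∎
    where open ≡.≡-Reasoning

  [κ₀∸m]*d≡κ₁∸m*d : ∀ m → (R₀.κ ∸ m) * d ≡ R₁.κ ∸ m * d
  [κ₀∸m]*d≡κ₁∸m*d m = ≡.trans (ℕₚ.*-distribʳ-∸ d R₀.κ m) (≡.cong (_∸ m * d) κ₀*d≡κ₁)

  [κ₀∸m+n]*d≡κ₁∸m*d+n*d : ∀ m n → (R₀.κ ∸ m + n) * d ≡ R₁.κ ∸ m * d + n * d
  [κ₀∸m+n]*d≡κ₁∸m*d+n*d m n =
    ≡.trans (ℕₚ.*-distribʳ-+ d (R₀.κ ∸ m) n) (≡.cong (_+ n * d) ([κ₀∸m]*d≡κ₁∸m*d m))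

  extend : R₀.R → R₁.R
  extend (inA a) = inA (fun a)
  extend (inD a) = inD (fun a)
  extend (inL i) = R₁.ℓR (R₀.level i * d)

  private
    inA-fun : ∀ {x y} → fun x A₁.≈ y → inA (fun x) ≈R inA y
    inA-fun = R₁.inA-≈

    inD-fun : ∀ {x y} → fun x A₁.≈ y → inD (fun x) ≈R inD y
    inD-fun e = R₁.inD-≈ (N₁'.δ-cong e)

    ℓR-cong : ∀ {n n'} → n ≡ n' → R₁.ℓR n ≈R R₁.ℓR n'
    ℓR-cong e = R₁.≈R-reflexive (≡.cong R₁.ℓR e)

  extend-0R : extend R₀.0R ≈R R₁.0R
  extend-0R = inD-fun pres-ε

  extend-1R : extend R₀.1R ≈R R₁.1R
  extend-1R = inA-fun pres-ε

  extend-ℓR : ∀ n → extend (R₀.ℓR n) ≈R R₁.ℓR (n * d)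
  extend-ℓR n with R₀.levelView n
  ... | R₀.bottom = extend-0R
  ... | R₀.middle i rewrite R₀.ℓR-level i = ≈R-refl
  ... | R₀.above κ₀≤n rewrite R₀.ℓR-≥κ κ₀≤n =
    ≈R-trans extend-1R
      (≈R-sym (R₁.≈R-reflexive (R₁.ℓR-≥κ (≡.subst (Nat._≤ n * d) κ₀*d≡κ₁ (ℕₚ.*-monoˡ-≤ d κ₀≤n)))))

  extend-mono : ∀ {x y} → x R₀.⊑ y → extend x ⊑ extend y
  extend-mono {inA a} {inA b} R₀.⟪ p ⟫ = ⟪ RLEmb-mono h p ⟫
  extend-mono {inA a} {inD b} R₀.⟪ () ⟫
  extend-mono {inA a} {inL j} R₀.⟪ () ⟫
  extend-mono {inD a} {inA b} p = ⟪ tt ⟫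
  extend-mono {inD a} {inD b} R₀.⟪ p ⟫ = ⟪ A₁'.≤-resp-≈ (h-δ b) (h-δ a) (RLEmb-mono h p) ⟫
  extend-mono {inD a} {inL j} p = R₁.inD⊑ℓR _ _ (1≤level*d j)
  extend-mono {inL i} {inA b} p = R₁.ℓR⊑inA _ _ (level*d≤k₁ i)
  extend-mono {inL i} {inD b} R₀.⟪ () ⟫
  extend-mono {inL i} {inL j} R₀.⟪ lift p ⟫ = R₁.ℓR-mono (ℕₚ.*-monoˡ-≤ d (s≤s p))

  extend-reflects : ∀ {x y} → extend x ⊑ extend y → x R₀.⊑ y
  extend-reflects {inA a} {inA b} ⟪ p ⟫ = R₀.⟪ RLEmb-reflects-≤ h p ⟫
  extend-reflects {inA a} {inD b} ⟪ () ⟫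
  extend-reflects {inA a} {inL j} p = ⊥-elim (ℕₚ.<⇒≱ (s≤s (level*d≤k₁ j)) (R₁.inA⊑ℓR⇒κ≤ _ _ p))
  extend-reflects {inD a} {inA b} p = R₀.⟪ tt ⟫
  extend-reflects {inD a} {inD b} ⟪ p ⟫ =
    R₀.⟪ RLEmb-reflects-≤ h (A₁'.≤-resp-≈ (A₁'.≈-sym (h-δ b)) (A₁'.≈-sym (h-δ a)) p) ⟫
  extend-reflects {inD a} {inL j} p = R₀.⟪ tt ⟫
  extend-reflects {inL i} {inA b} p = R₀.⟪ tt ⟫
  extend-reflects {inL i} {inD b} p = ⊥-elim (ℕₚ.<⇒≱ (1≤level*d i) (ℕₚ.≤-reflexive (R₁.ℓR⊑inD⇒≡0 _ _ p)))
  extend-reflects {inL i} {inL j} p = R₀.⟪ lift (s≤s⁻¹ (ℕₚ.*-cancelʳ-≤ (R₀.level i) (R₀.level j) d {{Nat.>-nonZero 1≤d}}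
    (R₁.ℓR⊑ℓR⇒≤ (1≤level*d i) (level*d≤k₁ i) p))) ⟫

  extend-cong : ∀ {x y} → x R₀.≈R y → extend x ≈R extend y
  extend-cong (p , q) = extend-mono p , extend-mono q

  extend-· : ∀ x y → extend (x R₀.·R y) ≈R (extend x R₁.·R extend y)
  extend-· (inA a) (inA b) = inA-fun (pres-· a b)
  extend-· (inA a) (inD b) = inD-fun (A₁'.≈-trans (pres-// _ _) (A₁.//-cong (h-δ b) A₁'.≈-refl))
  extend-· (inA a) (inL i) = ≈R-sym (R₁.inA·ℓR≈ℓR (fun a) _ (level*d≤k₁ i))
  extend-· (inD b) (inA a) = inD-fun (A₁'.≈-trans (pres-\\ _ _) (A₁.\\-cong A₁'.≈-refl (h-δ b)))
  extend-· (inD b) (inD c) = extend-0R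
  extend-· (inD b) (inL i) = ≈R-trans extend-0R (≈R-sym (R₁.inD·ℓR≈0R _ _ (level*d≤k₁ i)))
  extend-· (inL i) (inA a) = ≈R-sym (R₁.ℓR·inA≈ℓR _ _ (level*d≤k₁ i))
  extend-· (inL i) (inD b) = ≈R-trans extend-0R (≈R-sym (R₁.ℓR·inD≈0R _ _ (level*d≤k₁ i)))
  extend-· (inL i) (inL j) = begin
    extend (R₀.ℓR (R₀.level i + R₀.level j ∸ R₀.κ))   ≈⟨ extend-ℓR (R₀.level i + R₀.level j ∸ R₀.κ) ⟩
    R₁.ℓR ((R₀.level i + R₀.level j ∸ R₀.κ) * d)      ≈⟨ ℓR-cong ([m+n∸κ₀]*d≡m*d+n*d∸κ₁ (R₀.level i) (R₀.level j)) ⟩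
    R₁.ℓR (R₀.level i * d + R₀.level j * d ∸ R₁.κ)    ≈⟨ R₁.ℓR·ℓR≈ℓR _ _ (1≤level*d i) (level*d≤k₁ i) (level*d≤k₁ j) ⟨
    R₁.ℓR (R₀.level i * d) R₁.·R R₁.ℓR (R₀.level j * d) ∎
    where open R₁.≈R-Reasoning

  extend-\\ : ∀ x y → extend (x R₀.\\R y) ≈R (extend x R₁.\\R extend y)
  extend-\\ (inA a) (inA c) = inA-fun (pres-\\ a c)
  extend-\\ (inA a) (inD c) = inD-fun (pres-· c a)
  extend-\\ (inA a) (inL j) = ≈R-sym (R₁.inA\\ℓR≈ℓR (fun a) _ (1≤level*d j) (level*d≤k₁ j))
  extend-\\ (inD b) (inA c) = extend-1R
  extend-\\ (inD b) (inD c) = inA-fun (A₁'.≈-trans (pres-// _ _) (A₁.//-cong (h-δ b) (h-δ c)))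
  extend-\\ (inD b) (inL j) = ≈R-trans extend-1R (≈R-sym (R₁.inD\\ℓR≈1R _ _ (1≤level*d j)))
  extend-\\ (inL i) (inA c) = ≈R-trans extend-1R (≈R-sym (R₁.ℓR\\inA≈1R _ _ (level*d≤k₁ i)))
  extend-\\ (inL i) (inD c) = begin
    extend (R₀.ℓR (R₀.κ ∸ R₀.level i))  ≈⟨ extend-ℓR (R₀.κ ∸ R₀.level i) ⟩
    R₁.ℓR ((R₀.κ ∸ R₀.level i) * d)     ≈⟨ ℓR-cong ([κ₀∸m]*d≡κ₁∸m*d (R₀.level i)) ⟩
    R₁.ℓR (R₁.κ ∸ R₀.level i * d)       ≈⟨ R₁.ℓR\\inD≈ℓR _ _ (1≤level*d i) (level*d≤k₁ i) ⟨
    R₁.ℓR (R₀.level i * d) R₁.\\R inD (fun c) ∎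
    where open R₁.≈R-Reasoning
  extend-\\ (inL i) (inL j) = begin
    extend (R₀.ℓR (R₀.κ ∸ R₀.level i + R₀.level j))  ≈⟨ extend-ℓR (R₀.κ ∸ R₀.level i + R₀.level j) ⟩
    R₁.ℓR ((R₀.κ ∸ R₀.level i + R₀.level j) * d)     ≈⟨ ℓR-cong ([κ₀∸m+n]*d≡κ₁∸m*d+n*d (R₀.level i) (R₀.level j)) ⟩
    R₁.ℓR (R₁.κ ∸ R₀.level i * d + R₀.level j * d)   ≈⟨ R₁.ℓR\\ℓR≈ℓR _ _ (1≤level*d i) (level*d≤k₁ i) (level*d≤k₁ j) ⟨
    R₁.ℓR (R₀.level i * d) R₁.\\R R₁.ℓR (R₀.level j * d) ∎
    where open R₁.≈R-Reasoning

  extend-// : ∀ x y → extend (x R₀.//R y) ≈R (extend x R₁.//R extend y)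
  extend-// (inA c) (inA a) = inA-fun (pres-// c a)
  extend-// (inD c) (inA a) = inD-fun (pres-· a c)
  extend-// (inL j) (inA a) = ≈R-sym (R₁.ℓR//inA≈ℓR (fun a) _ (1≤level*d j) (level*d≤k₁ j))
  extend-// (inA c) (inD b) = extend-1R
  extend-// (inD c) (inD b) = inA-fun (A₁'.≈-trans (pres-\\ _ _) (A₁.\\-cong (h-δ c) (h-δ b)))
  extend-// (inL j) (inD b) = ≈R-trans extend-1R (≈R-sym (R₁.ℓR//inD≈1R _ _ (1≤level*d j)))
  extend-// (inA c) (inL i) = ≈R-trans extend-1R (≈R-sym (R₁.inA//ℓR≈1R _ _ (level*d≤k₁ i)))
  extend-// (inD c) (inL i) = begin
    extend (R₀.ℓR (R₀.κ ∸ R₀.level i))  ≈⟨ extend-ℓR (R₀.κ ∸ R₀.level i) ⟩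
    R₁.ℓR ((R₀.κ ∸ R₀.level i) * d)     ≈⟨ ℓR-cong ([κ₀∸m]*d≡κ₁∸m*d (R₀.level i)) ⟩
    R₁.ℓR (R₁.κ ∸ R₀.level i * d)       ≈⟨ R₁.inD//ℓR≈ℓR _ _ (1≤level*d i) (level*d≤k₁ i) ⟨
    inD (fun c) R₁.//R R₁.ℓR (R₀.level i * d) ∎
    where open R₁.≈R-Reasoning
  extend-// (inL j) (inL i) = begin
    extend (R₀.ℓR (R₀.κ ∸ R₀.level i + R₀.level j))  ≈⟨ extend-ℓR (R₀.κ ∸ R₀.level i + R₀.level j) ⟩
    R₁.ℓR ((R₀.κ ∸ R₀.level i + R₀.level j) * d)     ≈⟨ ℓR-cong ([κ₀∸m+n]*d≡κ₁∸m*d+n*d (R₀.level i) (R₀.level j)) ⟩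
    R₁.ℓR (R₁.κ ∸ R₀.level i * d + R₀.level j * d)   ≈⟨ R₁.ℓR//ℓR≈ℓR _ _ (1≤level*d i) (level*d≤k₁ i) (level*d≤k₁ j) ⟨
    R₁.ℓR (R₀.level j * d) R₁.//R R₁.ℓR (R₀.level i * d) ∎
    where open R₁.≈R-Reasoning

  private
    extend-∧-⊑ : ∀ x y → x R₀.⊑ y → extend (x R₀.∧R y) ≈R (extend x R₁.∧R extend y)
    extend-∧-⊑ x y p = ≈R-trans (extend-cong (R₀.x⊑y⇒x∧Ry≈x p)) (≈R-sym (R₁.x⊑y⇒x∧Ry≈x (extend-mono p)))

    extend-∧-⊒ : ∀ x y → y R₀.⊑ x → extend (x R₀.∧R y) ≈R (extend x R₁.∧R extend y)
    extend-∧-⊒ x y p = ≈R-trans (extend-cong (R₀.x⊑y⇒y∧Rx≈x p)) (≈R-sym (R₁.x⊑y⇒y∧Rx≈x (extend-mono p)))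

    extend-∨-⊑ : ∀ x y → x R₀.⊑ y → extend (x R₀.∨R y) ≈R (extend x R₁.∨R extend y)
    extend-∨-⊑ x y p = ≈R-trans (extend-cong (R₀.x⊑y⇒x∨Ry≈y p)) (≈R-sym (R₁.x⊑y⇒x∨Ry≈y (extend-mono p)))

    extend-∨-⊒ : ∀ x y → y R₀.⊑ x → extend (x R₀.∨R y) ≈R (extend x R₁.∨R extend y)
    extend-∨-⊒ x y p = ≈R-trans (extend-cong (R₀.x⊑y⇒y∨Rx≈y p)) (≈R-sym (R₁.x⊑y⇒y∨Rx≈y (extend-mono p)))

  extend-∧ : ∀ x y → extend (x R₀.∧R y) ≈R (extend x R₁.∧R extend y)
  extend-∧ (inA a) (inA b) = inA-fun (pres-∧ a b)
  extend-∧ (inA a) (inD b) = extend-∧-⊒ (inA a) (inD b) R₀.⟪ tt ⟫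
  extend-∧ (inA a) (inL j) = extend-∧-⊒ (inA a) (inL j) R₀.⟪ tt ⟫
  extend-∧ (inD a) (inA b) = extend-∧-⊑ (inD a) (inA b) R₀.⟪ tt ⟫
  extend-∧ (inD a) (inD b) = inD-fun (pres-∨ a b)
  extend-∧ (inD a) (inL j) = extend-∧-⊑ (inD a) (inL j) R₀.⟪ tt ⟫
  extend-∧ (inL i) (inA b) = extend-∧-⊑ (inL i) (inA b) R₀.⟪ tt ⟫
  extend-∧ (inL i) (inD b) = extend-∧-⊒ (inL i) (inD b) R₀.⟪ tt ⟫
  extend-∧ (inL i) (inL j) with R₀.inL-total i j
  ... | inj₁ i⊑j = extend-∧-⊑ (inL i) (inL j) i⊑j
  ... | inj₂ j⊑i = extend-∧-⊒ (inL i) (inL j) j⊑i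

  extend-∨ : ∀ x y → extend (x R₀.∨R y) ≈R (extend x R₁.∨R extend y)
  extend-∨ (inA a) (inA b) = inA-fun (pres-∨ a b)
  extend-∨ (inA a) (inD b) = extend-∨-⊒ (inA a) (inD b) R₀.⟪ tt ⟫
  extend-∨ (inA a) (inL j) = extend-∨-⊒ (inA a) (inL j) R₀.⟪ tt ⟫
  extend-∨ (inD a) (inA b) = extend-∨-⊑ (inD a) (inA b) R₀.⟪ tt ⟫
  extend-∨ (inD a) (inD b) = inD-fun (A₁'.≈-trans (pres-∧ _ _) (A₁'.∧-cong (h-δ a) (h-δ b)))
  extend-∨ (inD a) (inL j) = extend-∨-⊑ (inD a) (inL j) R₀.⟪ tt ⟫
  extend-∨ (inL i) (inA b) = extend-∨-⊑ (inL i) (inA b) R₀.⟪ tt ⟫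
  extend-∨ (inL i) (inD b) = extend-∨-⊒ (inL i) (inD b) R₀.⟪ tt ⟫
  extend-∨ (inL i) (inL j) with R₀.inL-total i j
  ... | inj₁ i⊑j = extend-∨-⊑ (inL i) (inL j) i⊑j
  ... | inj₂ j⊑i = extend-∨-⊒ (inL i) (inL j) j⊑i

  extension : FLEmb R₀.rotationFL R₁.rotationFL
  extension = record
    { emb = record
      { fun     = extend
      ; cong    = extend-cong
      ; inj     = λ (p , q) → extend-reflects p , extend-reflects q
      ; pres-∧  = extend-∧
      ; pres-∨  = extend-∨
      ; pres-·  = extend-·
      ; pres-\\ = extend-\\
      ; pres-// = extend-//
      ; pres-ε  = extend-1R
      }
    ; pres-0 = extend-0R
    }

module RotationEmbedding {c ℓ : Level}
  (A₀ : IRL c ℓ) (δ₀ : RL.Carrier (IRL.rl A₀) → RL.Carrier (IRL.rl A₀)) (N₀ : IsNucleus (IRL.rl A₀) δ₀) (k₀ : ℕ)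
  (A₁ : IRL c ℓ) (δ₁ : RL.Carrier (IRL.rl A₁) → RL.Carrier (IRL.rl A₁)) (N₁ : IsNucleus (IRL.rl A₁) δ₁) (k₁ : ℕ)
  (1≤k₀ : 1 Nat.≤ k₀)
  (e : FLEmb (RotationAlgebra.rotationFL A₀ δ₀ N₀ k₀) (RotationAlgebra.rotationFL A₁ δ₁ N₁ k₁)) where
  module R₀ = RotationAlgebra A₀ δ₀ N₀ k₀
  module R₁ = RotationAlgebra A₁ δ₁ N₁ k₁
  private
    module A₀ = RL (IRL.rl A₀)
    module A₁ = RL (IRL.rl A₁)
    module A₀' = RLProperties (IRL.rl A₀)
    module A₁' = RLProperties (IRL.rl A₁)
    module N₀' = NucleusProperties (IRL.rl A₀) δ₀ N₀
    module N₁' = NucleusProperties (IRL.rl A₁) δ₁ N₁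
    open RLEmb (FLEmb.emb e) using () renaming (cong to f-cong; pres-∧ to f-∧; pres-∨ to f-∨; pres-· to f-·;
                                                pres-\\ to f-\\; pres-// to f-//; pres-ε to f-1)
  open R₁ using (_≈R_; _⊑_; ⟪_⟫; ≈R-refl; ≈R-sym; ≈R-trans; ≈R-reflexive)
  open TruncatedArithmetic using (n≡m∸p+q⇒p≡m∸n+q)

  f : R₀.R → R₁.R
  f = RLEmb.fun (FLEmb.emb e)

  f-0 : f R₀.0R ≈R R₁.0R
  f-0 = FLEmb.pres-0 e

  f-reflects : ∀ {x y} → f x ⊑ f y → x R₀.⊑ y
  f-reflects p = R₀.x∧Ry≈x⇒x⊑y (RLEmb-reflects-≤ (FLEmb.emb e) (R₁.x⊑y⇒x∧Ry≈x p))

  f-^R : ∀ x n → f (x R₀.^R n) ≈R (f x R₁.^R n)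
  f-^R x zero = f-1
  f-^R x (suc n) = ≈R-trans (f-· x _) (R₁.·R-cong {f x} ≈R-refl (f-^R x n))

  f-inL⋢0R : ∀ i → ¬ (f (inL i) ⊑ R₁.0R)
  f-inL⋢0R i p with f-reflects (R₁.⊑-trans p (proj₂ f-0))
  ... | R₀.⟪ () ⟫

  private
    ℓ₁ : Fin k₀
    ℓ₁ = fromℕ< 1≤k₀

  f-inA-InA : ∀ a → R₁.InA (f (inA a))
  f-inA-InA a with R₁.x·Ry≈Ry⇒y⊑0R⊎InA (f (inA a)) (f (inL ℓ₁)) (≈R-sym (f-· (inA a) (inL ℓ₁)))
  ... | inj₁ fℓ₁⊑0R = ⊥-elim (f-inL⋢0R ℓ₁ fℓ₁⊑0R)
  ... | inj₂ inA-image = inA-image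

  base : A₀.Carrier → A₁.Carrier
  base a = proj₁ (f-inA-InA a)

  f-inA : ∀ a → f (inA a) ≡ inA (base a)
  f-inA a = proj₂ (f-inA-InA a)

  f-inD : ∀ a → f (inD a) ≈R inD (base a)
  f-inD a = begin
    f (inD a)                   ≈⟨ f-cong (R₀.inD-≈ (N₀'.δ-cong (A₀'.≈-sym (A₀'.identityˡ a)))) ⟩
    f (inA a R₀.\\R R₀.0R)      ≈⟨ f-\\ (inA a) R₀.0R ⟩
    f (inA a) R₁.\\R f R₀.0R    ≈⟨ R₁.\\R-cong (≈R-reflexive (f-inA a)) f-0 ⟩
    inA (base a) R₁.\\R R₁.0R   ≈⟨ R₁.inD-≈ (N₁'.δ-cong (A₁'.identityˡ (base a))) ⟩
    inD (base a)                ∎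
    where open R₁.≈R-Reasoning

  private
    base-≈ : ∀ {a y} → f (inA a) ≈R inA y → base a A₁.≈ y
    base-≈ {a} p = R₁.inA-≈⁻ (≈R-trans (≈R-reflexive (≡.sym (f-inA a))) p)

    base-pres : ∀ (_∙_ : R₁.R → R₁.R → R₁.R) {a b c y} →
                f (inA a) ≈R (f (inA b) ∙ f (inA c)) → (inA (base b) ∙ inA (base c)) ≡ inA y → base a A₁.≈ y
    base-pres _∙_ {b = b} {c} p q = base-≈ (≈R-trans p (≈R-reflexive (≡.trans (≡.cong₂ _∙_ (f-inA b) (f-inA c)) q)))

  baseEmb : RLEmb (IRL.rl A₀) (IRL.rl A₁)
  baseEmb = record
    { fun     = base
    ; cong    = λ p → base-≈ (≈R-trans (f-cong (R₀.inA-≈ p)) (≈R-reflexive (f-inA _)))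
    ; inj     = λ p → R₀.inA-≈⁻ (RLEmb.inj (FLEmb.emb e)
                  (≈R-trans (≈R-reflexive (f-inA _)) (≈R-trans (R₁.inA-≈ p) (≈R-reflexive (≡.sym (f-inA _))))))
    ; pres-∧  = λ a b → base-pres R₁._∧R_ (f-∧ (inA a) (inA b)) refl
    ; pres-∨  = λ a b → base-pres R₁._∨R_ (f-∨ (inA a) (inA b)) refl
    ; pres-·  = λ a b → base-pres R₁._·R_ (f-· (inA a) (inA b)) refl
    ; pres-\\ = λ a b → base-pres R₁._\\R_ (f-\\ (inA a) (inA b)) refl
    ; pres-// = λ a b → base-pres R₁._//R_ (f-// (inA a) (inA b)) refl
    ; pres-ε  = base-≈ f-1
    }

  f-inL∉InA : ∀ i → ¬ R₁.InA (f (inL i))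
  f-inL∉InA i (b , fℓ≡b) with R₁.inA^n≡inA b R₀.κ
  ... | c , bκ≡c with ≈R-trans (≈R-sym (f-^R (inL i) R₀.κ)) (≈R-trans (f-cong (R₀.inL^κ≈0R i)) f-0)
  ... | p , _ rewrite fℓ≡b | bκ≡c with p
  ... | ⟪ () ⟫

  f-inL≢inD : ∀ i b → f (inL i) ≢ inD b
  f-inL≢inD i b fℓ≡b with R₀.levelOf (R₀.1≤κ∸level i) (R₀.κ∸level≤k i)
  ... | j , level-j = f-inL∉InA j (R₁.≈inA⇒InA (begin
    f (inL j)                      ≡⟨ ≡.cong f (≡.trans (≡.sym (R₀.ℓR-level j)) (≡.cong R₀.ℓR level-j)) ⟩
    f (inL i R₀.\\R R₀.0R)         ≈⟨ f-\\ (inL i) R₀.0R ⟩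
    f (inL i) R₁.\\R f R₀.0R       ≈⟨ R₁.\\R-cong (≈R-reflexive fℓ≡b) f-0 ⟩
    inA (δ₁ b A₁.// δ₁ A₁.ε)       ∎))
    where open R₁.≈R-Reasoning

  f-inL : ∀ i → Σ (Fin k₁) λ j → f (inL i) ≡ inL j
  f-inL i with f (inL i) in fℓ≡
  ... | inA b = ⊥-elim (f-inL∉InA i (b , fℓ≡))
  ... | inD b = ⊥-elim (f-inL≢inD i b fℓ≡)
  ... | inL j = j , refl

  imageLevel : ℕ → ℕ
  imageLevel n with R₀.levelView n
  ... | R₀.bottom = 0
  ... | R₀.middle i = R₁.level (proj₁ (f-inL i))
  ... | R₀.above _ = R₁.κ

  f-ℓR : ∀ n → f (R₀.ℓR n) ≈R R₁.ℓR (imageLevel n)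
  f-ℓR n with R₀.levelView n
  ... | R₀.bottom = f-0
  ... | R₀.middle i rewrite R₀.ℓR-level i | R₁.ℓR-level (proj₁ (f-inL i)) = ≈R-reflexive (proj₂ (f-inL i))
  ... | R₀.above κ₀≤n rewrite R₀.ℓR-≥κ κ₀≤n | R₁.ℓR-≥κ (ℕₚ.≤-refl {R₁.κ}) = f-1

  imageLevel≤k₁ : ∀ n → n Nat.≤ k₀ → imageLevel n Nat.≤ k₁
  imageLevel≤k₁ n n≤k₀ with R₀.levelView n
  ... | R₀.bottom = z≤n
  ... | R₀.middle i = R₁.level≤k (proj₁ (f-inL i))
  ... | R₀.above κ₀≤n = ⊥-elim (ℕₚ.<⇒≱ κ₀≤n n≤k₀)

  1≤imageLevel : ∀ n → 1 Nat.≤ n → n Nat.≤ k₀ → 1 Nat.≤ imageLevel n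
  1≤imageLevel n 1≤n n≤k₀ with R₀.levelView n
  ... | R₀.bottom = ⊥-elim (ℕₚ.n≮0 1≤n)
  ... | R₀.middle i = s≤s z≤n
  ... | R₀.above κ₀≤n = ⊥-elim (ℕₚ.<⇒≱ κ₀≤n n≤k₀)

  imageLevel-step : ∀ n → n Nat.< k₀ → imageLevel k₀ ≡ R₁.κ ∸ imageLevel (suc n) + imageLevel n
  imageLevel-step n n<k₀ = R₁.ℓR-injective (1≤imageLevel k₀ 1≤k₀ ℕₚ.≤-refl) (imageLevel≤k₁ k₀ ℕₚ.≤-refl) (begin
    R₁.ℓR (imageLevel k₀)                                  ≈⟨ f-ℓR k₀ ⟨
    f (R₀.ℓR k₀)                                           ≈⟨ f-cong (R₀.ℓR[1+n]\\ℓR[n]≈ℓR[k] n n<k₀) ⟨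
    f (R₀.ℓR (suc n) R₀.\\R R₀.ℓR n)                       ≈⟨ f-\\ (R₀.ℓR (suc n)) (R₀.ℓR n) ⟩
    f (R₀.ℓR (suc n)) R₁.\\R f (R₀.ℓR n)                   ≈⟨ R₁.\\R-cong (f-ℓR (suc n)) (f-ℓR n) ⟩
    R₁.ℓR (imageLevel (suc n)) R₁.\\R R₁.ℓR (imageLevel n) ≈⟨ R₁.ℓR\\ℓR≈ℓR _ _ 1≤image[1+n] image[1+n]≤k₁ image[n]≤k₁ ⟩
    R₁.ℓR (R₁.κ ∸ imageLevel (suc n) + imageLevel n)       ∎)
    where
    open R₁.≈R-Reasoning
    1≤image[1+n] : 1 Nat.≤ imageLevel (suc n)
    1≤image[1+n] = 1≤imageLevel (suc n) (s≤s z≤n) n<k₀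
    image[1+n]≤k₁ : imageLevel (suc n) Nat.≤ k₁
    image[1+n]≤k₁ = imageLevel≤k₁ (suc n) n<k₀
    image[n]≤k₁ : imageLevel n Nat.≤ k₁
    image[n]≤k₁ = imageLevel≤k₁ n (ℕₚ.<⇒≤ n<k₀)

  scale : ℕ
  scale = R₁.κ ∸ imageLevel k₀

  private
    imageLevel≤κ₁ : ∀ n → n Nat.≤ k₀ → imageLevel n Nat.≤ R₁.κ
    imageLevel≤κ₁ n n≤k₀ = ℕₚ.m≤n⇒m≤1+n (imageLevel≤k₁ n n≤k₀)

  imageLevel≡n*scale : ∀ n → n Nat.≤ k₀ → imageLevel n ≡ n * scale
  imageLevel≡n*scale zero    _    = refl
  imageLevel≡n*scale (suc n) n<k₀ = begin
    imageLevel (suc n)    ≡⟨ n≡m∸p+q⇒p≡m∸n+q R₁.κ (imageLevel k₀) (imageLevel (suc n)) (imageLevel n)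
                               (imageLevel≤κ₁ (suc n) n<k₀) (imageLevel≤κ₁ k₀ ℕₚ.≤-refl) (imageLevel-step n n<k₀) ⟩
    scale + imageLevel n  ≡⟨ ≡.cong (scale +_) (imageLevel≡n*scale n (ℕₚ.<⇒≤ n<k₀)) ⟩
    scale + n * scale     ∎
    where open ≡.≡-Reasoning

  κ₁≡κ₀*scale : R₁.κ ≡ R₀.κ * scale
  κ₁≡κ₀*scale = begin
    R₁.κ                   ≡⟨ ℕₚ.m∸n+n≡m (imageLevel≤κ₁ k₀ ℕₚ.≤-refl) ⟨
    scale + imageLevel k₀  ≡⟨ ≡.cong (scale +_) (imageLevel≡n*scale k₀ ℕₚ.≤-refl) ⟩
    scale + k₀ * scale     ∎
    where open ≡.≡-Reasoning

  f-inL≈ℓR : ∀ i → f (inL i) ≈R R₁.ℓR (R₀.level i * scale)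
  f-inL≈ℓR i = begin
    f (inL i)                        ≡⟨ ≡.cong f (R₀.ℓR-level i) ⟨
    f (R₀.ℓR (R₀.level i))           ≈⟨ f-ℓR (R₀.level i) ⟩
    R₁.ℓR (imageLevel (R₀.level i))  ≡⟨ ≡.cong R₁.ℓR (imageLevel≡n*scale (R₀.level i) (R₀.level≤k i)) ⟩
    R₁.ℓR (R₀.level i * scale)       ∎
    where open R₁.≈R-Reasoning

IRLAmalgam : ∀ {c ℓ k} → (IRL c ℓ → Set k) → {A B C : IRL c ℓ} →
             RLEmb (IRL.rl A) (IRL.rl B) → RLEmb (IRL.rl A) (IRL.rl C) → Set (lsuc (c ⊔ˡ ℓ) ⊔ˡ k)
IRLAmalgam {c} {ℓ} P {A} {B} {C} i j =
  Σ (IRL c ℓ) λ D → P D ×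
  Σ (RLEmb (IRL.rl B) (IRL.rl D)) λ h →
  Σ (RLEmb (IRL.rl C) (IRL.rl D)) λ k →
  ∀ a → RL._≈_ (IRL.rl D) (RLEmb.fun h (RLEmb.fun i a)) (RLEmb.fun k (RLEmb.fun j a))

FLAmalgam : ∀ {c ℓ k} → (FL c ℓ → Set k) → {A B C : FL c ℓ} → FLEmb A B → FLEmb A C → Set (lsuc (c ⊔ˡ ℓ) ⊔ˡ k)
FLAmalgam {c} {ℓ} P {A} {B} {C} i j =
  Σ (FL c ℓ) λ D → P D ×
  Σ (FLEmb B D) λ h →
  Σ (FLEmb C D) λ k →
  ∀ a → RL._≈_ (FL.rl D) (RLEmb.fun (FLEmb.emb h) (RLEmb.fun (FLEmb.emb i) a))
                         (RLEmb.fun (FLEmb.emb k) (RLEmb.fun (FLEmb.emb j) a))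

FLAmalgam-map : ∀ {c ℓ k k'} {P : FL c ℓ → Set k} {Q : FL c ℓ → Set k'} {A B C : FL c ℓ}
                {i : FLEmb A B} {j : FLEmb A C} → (∀ D → P D → Q D) → FLAmalgam P i j → FLAmalgam Q i j
FLAmalgam-map P⊆Q (D , PD , h , k , commutes) = D , P⊆Q D PD , h , k , commutes

module Amalgamation {c ℓ k} (K : IRL c ℓ → Set k) (δ : Term) (nucleus : IsTermNucleus K δ) where
  open TruncatedArithmetic using (1≤m∸2; suc[n∸2]≡suc[m∸2]*quotient)

  δ⟨_⟩ : (A : IRL c ℓ) → RL.Carrier (IRL.rl A) → RL.Carrier (IRL.rl A)
  δ⟨ A ⟩ = eval (IRL.rl A) δ

  rotation : (n : ℕ) (A : IRL c ℓ) → K A → FL c ℓ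
  rotation n A KA = RotationAlgebra.rotationFL A δ⟨ A ⟩ (nucleus A KA) (n ∸ 2)

  rotation∈RotClass : ∀ n A (KA : K A) → RotClass K δ n (rotation n A KA)
  rotation∈RotClass n A KA = A , KA , RotationIsomorphism.isRotation A δ⟨ A ⟩ (nucleus A KA) n

  module _ (apK : APᴵ K) {n m₀ m₁ m₂ : ℕ}
           (n≥3 : 3 Nat.≤ n) (m₀≥3 : 3 Nat.≤ m₀) (m₁≥2 : 2 Nat.≤ m₁) (m₂≥2 : 2 Nat.≤ m₂)
           (m₁∣n : (m₁ ∸ 1) ∣ (n ∸ 1)) (m₂∣n : (m₂ ∸ 1) ∣ (n ∸ 1))
           {A₀ A₁ A₂ : IRL c ℓ} (KA₀ : K A₀) (KA₁ : K A₁) (KA₂ : K A₂) {B₀ B₁ B₂ : FL c ℓ}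
           (iso₀ : IsRotation (IRL.rl A₀) δ⟨ A₀ ⟩ m₀ B₀) (iso₁ : IsRotation (IRL.rl A₁) δ⟨ A₁ ⟩ m₁ B₁)
           (iso₂ : IsRotation (IRL.rl A₂) δ⟨ A₂ ⟩ m₂ B₂) (i : FLEmb B₀ B₁) (j : FLEmb B₀ B₂) where
    private
      module I₀ = RotationIsomorphism A₀ δ⟨ A₀ ⟩ (nucleus A₀ KA₀) m₀
      module I₁ = RotationIsomorphism A₁ δ⟨ A₁ ⟩ (nucleus A₁ KA₁) m₁
      module I₂ = RotationIsomorphism A₂ δ⟨ A₂ ⟩ (nucleus A₂ KA₂) m₂
      module Cᵢ = RotationEmbedding A₀ δ⟨ A₀ ⟩ (nucleus A₀ KA₀) (m₀ ∸ 2) A₁ δ⟨ A₁ ⟩ (nucleus A₁ KA₁) (m₁ ∸ 2)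
                    (1≤m∸2 m₀≥3) (FLEmb-∘ (I₁.toRotation B₁ iso₁) (FLEmb-∘ i (I₀.fromRotation B₀ iso₀)))
      module Cⱼ = RotationEmbedding A₀ δ⟨ A₀ ⟩ (nucleus A₀ KA₀) (m₀ ∸ 2) A₂ δ⟨ A₂ ⟩ (nucleus A₂ KA₂) (m₂ ∸ 2)
                    (1≤m∸2 m₀≥3) (FLEmb-∘ (I₂.toRotation B₂ iso₂) (FLEmb-∘ j (I₀.fromRotation B₀ iso₀)))

    module _ {A : IRL c ℓ} (KA : K A) (h : RLEmb (IRL.rl A₁) (IRL.rl A)) (k : RLEmb (IRL.rl A₂) (IRL.rl A))
             (h∘gᵢ≈k∘gⱼ : ∀ a → RL._≈_ (IRL.rl A) (RLEmb.fun h (Cᵢ.base a)) (RLEmb.fun k (Cⱼ.base a))) where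
      private
        dₕ dₖ : ℕ
        dₕ = _∣_.quotient m₁∣n
        dₖ = _∣_.quotient m₂∣n

        module R = RotationAlgebra A δ⟨ A ⟩ (nucleus A KA) (n ∸ 2)
        module R₀ = RotationAlgebra A₀ δ⟨ A₀ ⟩ (nucleus A₀ KA₀) (m₀ ∸ 2)
        module N = NucleusProperties (IRL.rl A) δ⟨ A ⟩ (nucleus A KA)
        module Eₕ = RotationExtension A₁ δ⟨ A₁ ⟩ (nucleus A₁ KA₁) (m₁ ∸ 2) A δ⟨ A ⟩ (nucleus A KA) (n ∸ 2)
                      h (RLEmb-eval h δ) dₕ (suc[n∸2]≡suc[m∸2]*quotient m₁≥2 (ℕₚ.<⇒≤ n≥3) m₁∣n)
        module Eₖ = RotationExtension A₂ δ⟨ A₂ ⟩ (nucleus A₂ KA₂) (m₂ ∸ 2) A δ⟨ A ⟩ (nucleus A KA) (n ∸ 2)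
                      k (RLEmb-eval k δ) dₖ (suc[n∸2]≡suc[m∸2]*quotient m₂≥2 (ℕₚ.<⇒≤ n≥3) m₂∣n)
        open R using (_≈R_; ≈R-sym; ≈R-trans)

        ψ₁ : FLEmb B₁ (rotation m₁ A₁ KA₁)
        ψ₁ = I₁.toRotation B₁ iso₁

        ψ₂ : FLEmb B₂ (rotation m₂ A₂ KA₂)
        ψ₂ = I₂.toRotation B₂ iso₂

      scaleᵢ*dₕ≡scaleⱼ*dₖ : Cᵢ.scale * dₕ ≡ Cⱼ.scale * dₖ
      scaleᵢ*dₕ≡scaleⱼ*dₖ = ℕₚ.*-cancelˡ-≡ _ _ R₀.κ (begin
        R₀.κ * (Cᵢ.scale * dₕ)  ≡⟨ ℕₚ.*-assoc R₀.κ Cᵢ.scale dₕ ⟨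
        R₀.κ * Cᵢ.scale * dₕ    ≡⟨ ≡.cong (_* dₕ) Cᵢ.κ₁≡κ₀*scale ⟨
        Cᵢ.R₁.κ * dₕ            ≡⟨ Eₕ.κ₀*d≡κ₁ ⟩
        R.κ                     ≡⟨ Eₖ.κ₀*d≡κ₁ ⟨
        Cⱼ.R₁.κ * dₖ            ≡⟨ ≡.cong (_* dₖ) Cⱼ.κ₁≡κ₀*scale ⟩
        R₀.κ * Cⱼ.scale * dₖ    ≡⟨ ℕₚ.*-assoc R₀.κ Cⱼ.scale dₖ ⟩
        R₀.κ * (Cⱼ.scale * dₖ)  ∎)
        where open ≡.≡-Reasoning

      commutes-on-rotation : ∀ x → Eₕ.extend (Cᵢ.f x) ≈R Eₖ.extend (Cⱼ.f x)
      commutes-on-rotation (inA a) = begin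
        Eₕ.extend (Cᵢ.f (inA a))        ≡⟨ ≡.cong Eₕ.extend (Cᵢ.f-inA a) ⟩
        inA (RLEmb.fun h (Cᵢ.base a))   ≈⟨ R.inA-≈ (h∘gᵢ≈k∘gⱼ a) ⟩
        inA (RLEmb.fun k (Cⱼ.base a))   ≡⟨ ≡.cong Eₖ.extend (Cⱼ.f-inA a) ⟨
        Eₖ.extend (Cⱼ.f (inA a))        ∎
        where open R.≈R-Reasoning
      commutes-on-rotation (inD a) = begin
        Eₕ.extend (Cᵢ.f (inD a))        ≈⟨ Eₕ.extend-cong (Cᵢ.f-inD a) ⟩
        inD (RLEmb.fun h (Cᵢ.base a))   ≈⟨ R.inD-≈ (N.δ-cong (h∘gᵢ≈k∘gⱼ a)) ⟩
        inD (RLEmb.fun k (Cⱼ.base a))   ≈⟨ Eₖ.extend-cong (Cⱼ.f-inD a) ⟨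
        Eₖ.extend (Cⱼ.f (inD a))        ∎
        where open R.≈R-Reasoning
      commutes-on-rotation (inL t) = begin
        Eₕ.extend (Cᵢ.f (inL t))                      ≈⟨ Eₕ.extend-cong (Cᵢ.f-inL≈ℓR t) ⟩
        Eₕ.extend (Cᵢ.R₁.ℓR (R₀.level t * Cᵢ.scale))  ≈⟨ Eₕ.extend-ℓR (R₀.level t * Cᵢ.scale) ⟩
        R.ℓR (R₀.level t * Cᵢ.scale * dₕ)             ≡⟨ ≡.cong R.ℓR (ℕₚ.*-assoc (R₀.level t) Cᵢ.scale dₕ) ⟩
        R.ℓR (R₀.level t * (Cᵢ.scale * dₕ))           ≡⟨ ≡.cong (λ s → R.ℓR (R₀.level t * s)) scaleᵢ*dₕ≡scaleⱼ*dₖ ⟩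
        R.ℓR (R₀.level t * (Cⱼ.scale * dₖ))           ≡⟨ ≡.cong R.ℓR (ℕₚ.*-assoc (R₀.level t) Cⱼ.scale dₖ) ⟨
        R.ℓR (R₀.level t * Cⱼ.scale * dₖ)             ≈⟨ Eₖ.extend-ℓR (R₀.level t * Cⱼ.scale) ⟨
        Eₖ.extend (Cⱼ.R₁.ℓR (R₀.level t * Cⱼ.scale))  ≈⟨ Eₖ.extend-cong (Cⱼ.f-inL≈ℓR t) ⟨
        Eₖ.extend (Cⱼ.f (inL t))                      ∎
        where open R.≈R-Reasoning

      lifted-amalgam : FLAmalgam (RotClass K δ n) i j
      lifted-amalgam = rotation n A KA , rotation∈RotClass n A KA ,
                       FLEmb-∘ Eₕ.extension ψ₁ , FLEmb-∘ Eₖ.extension ψ₂ , commutes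
        where
        -- Every b is the image of the rotation element ψ₀ b, on which both sides agree.
        commutes : ∀ b → Eₕ.extend (RLEmb.fun (FLEmb.emb ψ₁) (RLEmb.fun (FLEmb.emb i) b))
                      ≈R Eₖ.extend (RLEmb.fun (FLEmb.emb ψ₂) (RLEmb.fun (FLEmb.emb j) b))
        commutes b = ≈R-trans (RLEmb.cong (FLEmb.emb (FLEmb-∘ (FLEmb-∘ Eₕ.extension ψ₁) i)) b≈φψb)
                    (≈R-trans (commutes-on-rotation (RLEmb.fun (FLEmb.emb (I₀.toRotation B₀ iso₀)) b))
                    (≈R-sym (RLEmb.cong (FLEmb.emb (FLEmb-∘ (FLEmb-∘ Eₖ.extension ψ₂) j)) b≈φψb)))
          where
          b≈φψb : RL._≈_ (FL.rl B₀) b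
                    (RLEmb.fun (FLEmb.emb (I₀.fromRotation B₀ iso₀)) (RLEmb.fun (FLEmb.emb (I₀.toRotation B₀ iso₀)) b))
          b≈φψb = RLProperties.≈-sym (FL.rl B₀) (I₀.fromRotation∘toRotation B₀ iso₀ b)

    rotations-amalgam : FLAmalgam (RotClass K δ n) i j
    rotations-amalgam = lift-amalgam (apK A₀ A₁ A₂ KA₀ KA₁ KA₂ Cᵢ.baseEmb Cⱼ.baseEmb)
      where
      lift-amalgam : IRLAmalgam K {A₀} {A₁} {A₂} Cᵢ.baseEmb Cⱼ.baseEmb → FLAmalgam (RotClass K δ n) i j
      lift-amalgam (A , KA , h , k , h∘gᵢ≈k∘gⱼ) = lifted-amalgam KA h k h∘gᵢ≈k∘gⱼ

  module _ {n : ℕ} (n≥3 : 3 Nat.≤ n) {A₀ A₁ A₂ : IRL c ℓ} (KA₀ : K A₀) (KA₁ : K A₁) (KA₂ : K A₂)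
           (i : RLEmb (IRL.rl A₀) (IRL.rl A₁)) (j : RLEmb (IRL.rl A₀) (IRL.rl A₂)) where
    private
      1+m≡[1+m]*1 : ∀ m → suc m ≡ suc m * 1
      1+m≡[1+m]*1 m = ≡.sym (ℕₚ.*-identityʳ (suc m))

    extensionᵢ : FLEmb (rotation n A₀ KA₀) (rotation n A₁ KA₁)
    extensionᵢ = RotationExtension.extension A₀ δ⟨ A₀ ⟩ (nucleus A₀ KA₀) (n ∸ 2) A₁ δ⟨ A₁ ⟩ (nucleus A₁ KA₁) (n ∸ 2)
                   i (RLEmb-eval i δ) 1 (1+m≡[1+m]*1 (n ∸ 2))

    extensionⱼ : FLEmb (rotation n A₀ KA₀) (rotation n A₂ KA₂)
    extensionⱼ = RotationExtension.extension A₀ δ⟨ A₀ ⟩ (nucleus A₀ KA₀) (n ∸ 2) A₂ δ⟨ A₂ ⟩ (nucleus A₂ KA₂) (n ∸ 2)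
                   j (RLEmb-eval j δ) 1 (1+m≡[1+m]*1 (n ∸ 2))

    module _ {D : FL c ℓ} {m : ℕ} {A : IRL c ℓ} (KA : K A)
             (iso : IsRotation (IRL.rl A) δ⟨ A ⟩ m D) (h : FLEmb (rotation n A₁ KA₁) D) (k : FLEmb (rotation n A₂ KA₂) D)
             (h∘i≈k∘j : ∀ x → RL._≈_ (FL.rl D) (RLEmb.fun (FLEmb.emb h) (RLEmb.fun (FLEmb.emb extensionᵢ) x))
                                               (RLEmb.fun (FLEmb.emb k) (RLEmb.fun (FLEmb.emb extensionⱼ) x))) where
      private
        module I = RotationIsomorphism A δ⟨ A ⟩ (nucleus A KA) m
        module Cₕ = RotationEmbedding A₁ δ⟨ A₁ ⟩ (nucleus A₁ KA₁) (n ∸ 2) A δ⟨ A ⟩ (nucleus A KA) (m ∸ 2)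
                      (1≤m∸2 n≥3) (FLEmb-∘ (I.toRotation D iso) h)
        module Cₖ = RotationEmbedding A₂ δ⟨ A₂ ⟩ (nucleus A₂ KA₂) (n ∸ 2) A δ⟨ A ⟩ (nucleus A KA) (m ∸ 2)
                      (1≤m∸2 n≥3) (FLEmb-∘ (I.toRotation D iso) k)
        module R = RotationAlgebra A δ⟨ A ⟩ (nucleus A KA) (m ∸ 2)

      restricted-amalgam : IRLAmalgam K {A₀} {A₁} {A₂} i j
      restricted-amalgam = A , KA , Cₕ.baseEmb , Cₖ.baseEmb , λ a → R.inA-≈⁻ (begin
        inA (Cₕ.base (RLEmb.fun i a))  ≡⟨ Cₕ.f-inA (RLEmb.fun i a) ⟨
        Cₕ.f (inA (RLEmb.fun i a))     ≈⟨ RLEmb.cong (FLEmb.emb (I.toRotation D iso)) (h∘i≈k∘j (inA a)) ⟩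
        Cₖ.f (inA (RLEmb.fun j a))     ≡⟨ Cₖ.f-inA (RLEmb.fun j a) ⟩
        inA (Cₖ.base (RLEmb.fun j a))  ∎)
        where open R.≈R-Reasoning

    base-amalgam : FLAmalgam (λ D → Σ ℕ λ m → RotClass K δ m D) extensionᵢ extensionⱼ → IRLAmalgam K {A₀} {A₁} {A₂} i j
    base-amalgam (D , (m , A , KA , iso) , h , k , h∘i≈k∘j) = restricted-amalgam {m = m} KA iso h k h∘i≈k∘j

  AP-of-rotations⇒AP : ∀ {k'} (P : FL c ℓ → Set k') {n} → 3 Nat.≤ n →
                       (∀ A (KA : K A) → P (rotation n A KA)) →
                       (∀ D → P D → Σ ℕ λ m → RotClass K δ m D) →
                       APᶠ P → APᴵ K
  AP-of-rotations⇒AP P {n} n≥3 rotation∈P P⊆rotations apP A₀ A₁ A₂ KA₀ KA₁ KA₂ i j =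
    base-amalgam n≥3 KA₀ KA₁ KA₂ i j (FLAmalgam-map {i = eᵢ} {eⱼ} P⊆rotations
      (apP _ _ _ (rotation∈P A₀ KA₀) (rotation∈P A₁ KA₁) (rotation∈P A₂ KA₂) eᵢ eⱼ))
    where
    eᵢ : FLEmb (rotation n A₀ KA₀) (rotation n A₁ KA₁)
    eᵢ = extensionᵢ n≥3 KA₀ KA₁ KA₂ i j
    eⱼ : FLEmb (rotation n A₀ KA₀) (rotation n A₂ KA₂)
    eⱼ = extensionⱼ n≥3 KA₀ KA₁ KA₂ i j

  AP⇒AP-of-rotations : APᴵ K → ∀ {n m₀ m₁ m₂} → 3 Nat.≤ n → 3 Nat.≤ m₀ → 2 Nat.≤ m₁ → 2 Nat.≤ m₂ →
                       (m₁ ∸ 1) ∣ (n ∸ 1) → (m₂ ∸ 1) ∣ (n ∸ 1) → ∀ {B₀ B₁ B₂} →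
                       RotClass K δ m₀ B₀ → RotClass K δ m₁ B₁ → RotClass K δ m₂ B₂ →
                       (i : FLEmb B₀ B₁) (j : FLEmb B₀ B₂) → FLAmalgam (RotClass K δ n) i j
  AP⇒AP-of-rotations apK n≥3 m₀≥3 m₁≥2 m₂≥2 m₁∣n m₂∣n (A₀ , KA₀ , iso₀) (A₁ , KA₁ , iso₁) (A₂ , KA₂ , iso₂) =
    rotations-amalgam apK n≥3 m₀≥3 m₁≥2 m₂≥2 m₁∣n m₂∣n KA₀ KA₁ KA₂ iso₀ iso₁ iso₂

open Nat using (_≤_)

proposition6p3 : ∀ {c ℓ k} (K : IRL c ℓ → Set k) (δ : Term) →
    IsTermNucleus K δ → (n : ℕ) → 3 ≤ n →
    (APᴵ K ⇔ APᶠ (RotClass K δ n))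
    × (APᴵ K ⇔ APᶠ (λ B → Σ ℕ λ m → 3 ≤ m × (m ∸ 1) ∣ (n ∸ 1) × RotClass K δ m B))
proposition6p3 K δ nucleus n n≥3 =
  mk⇔ (λ apK _ _ _ p₀ p₁ p₂ → AP⇒AP-of-rotations apK n≥3 n≥3 n≥2 n≥2 ∣-refl ∣-refl p₀ p₁ p₂)
      (AP-of-rotations⇒AP (RotClass K δ n) n≥3 (rotation∈RotClass n) (λ _ p → n , p)) ,
  mk⇔ (λ apK _ _ _ (_ , m₀≥3 , _ , p₀) (_ , m₁≥3 , m₁∣n , p₁) (_ , m₂≥3 , m₂∣n , p₂) i j →
         FLAmalgam-map {i = i} {j} (λ _ p → n , n≥3 , ∣-refl , p)
           (AP⇒AP-of-rotations apK n≥3 m₀≥3 (ℕₚ.<⇒≤ m₁≥3) (ℕₚ.<⇒≤ m₂≥3) m₁∣n m₂∣n p₀ p₁ p₂ i j))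
      (AP-of-rotations⇒AP _ n≥3 (λ A KA → n , n≥3 , ∣-refl , rotation∈RotClass n A KA)
                                 (λ _ (m , _ , _ , p) → m , p))
  where
  open Amalgamation K δ nucleus
  n≥2 : 2 ≤ n
  n≥2 = ℕₚ.<⇒≤ n≥3
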